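{- Let $R\subseteq[n-1]$, let $\pi\in S_n^R$ be $R$-312-avoiding, and let $\sigma\in S_n$ be the minimum length 312-avoiding permutation whose $R$-projection is $\pi$. Then $\Delta_R[\Psi(\sigma)]=\Psi_R(\pi)$, and $\sigma=\Pi[\Phi_R(\Psi_R(\pi))]$.
   Context: Fix $n\ge1$; $[m]=\{1,\dots,m\}$, $(a,b]=\{a+1,\dots,b\}$; $\mathrm{rank}^d(Q)$ = $d$-th largest element of finite $Q\subset\mathbb{Z}$. Write $R=\{q_1<\cdots<q_r\}$, $q_0=0$, $q_{r+1}=n$, $p_h=q_h-q_{h-1}$, carrels $(q_{h-1},q_h]$. $\sigma\in S_n$ is 312-avoiding if there are no $a<b<c$ with $\sigma_b<\sigma_c<\sigma_a$; length = number of inversions. $S_n^R$: permutations strictly increasing on each carrel; $\pi\in S_n^R$ is $R$-312-containing if there exist $h\in[r-1]$, $a\le q_h<b\le q_{h+1}<c\le n$ with $\pi_b<\pi_c<\pi_a$, else $R$-312-avoiding. $R$-projection of $\sigma$: sort entries within each carrel increasingly. $\Psi_R(\pi)_i=\mathrm{rank}^{q_h-i+1}(\{\pi_1,\dots,\pi_{q_h}\})$ for $i\in(q_{h-1},q_h]$; $\Psi:=\Psi_{[n-1]}$, so $\Psi(\sigma)_i=\max\{\sigma_1,\dots,\sigma_i\}$. $\Pi:=\Pi_{[n-1]}$: for an upper flag $\varphi$ (weakly increasing, $\varphi_i\ge i$, entries in $[n]$), $\Pi(\varphi)=\pi$ with $\pi_1=\varphi_1$ and $\pi_{i+1}=\max([\varphi_{i+1}]\setminus\{\pi_1,\dots,\pi_i\})$.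 Gapless $R$-tuple: $\gamma\in[n]^n$ with $\gamma_i\ge i$, strictly increasing on carrels, such that for each $h\in[r]$ with $\gamma_{q_h}>\gamma_{q_h+1}$, $s=\gamma_{q_h}-\gamma_{q_h+1}+1\le p_{h+1}$ and $\gamma_{q_h+t}=\gamma_{q_h}-s+t$, $t=1,\dots,s$. Critical indices of an upper tuple $\upsilon$ ($\upsilon_i\ge i$): in carrel $h$, $x_1=q_h$, and while possible $x_u$ = largest $x\in(q_{h-1},x_{u-1})$ with $\upsilon_{x_{u-1}}-\upsilon_x>x_{u-1}-x$. $R$-core $\Delta_R(\upsilon)$: equals $\upsilon_x$ at critical $x$ and $\upsilon_x-(x-i)$ at non-critical $i$, $x$ the smallest critical index $>i$ (applied to $\Psi(\sigma)$ regarded with the carrels of $R$). For gapless $\gamma$: $\Phi_R(\gamma)_i=\max\{\gamma_{q_h},\gamma_i\}$ if $h\in[r]$ and $q_h<i<x$ with $x$ the smallest critical index of $\gamma$ in $(q_h,q_{h+1}]$, else $\gamma_i$. -}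

module Defs where

open import Data.Bool using (Bool; true; false; if_then_else_; _∧_)
open import Data.Nat using (ℕ; zero; suc; _+_; _∸_; _≤_; _<_; _<ᵇ_; _≤ᵇ_; _≡ᵇ_; _⊔_; _⊓_; _<?_)
open import Data.Nat.Properties using (≤-decTotalOrder)
open import Data.List using (List; []; _∷_; _++_; map; upTo; foldr; reverse; length; filter; concatMap)
open import Data.Bool.ListAction using (any)
open import Data.Maybe using (Maybe; just; nothing; maybe′)
open import Data.Product using (_×_; _,_; proj₁; proj₂; ∃-syntax)
open import Data.List.Membership.Propositional using (_∉_)
open import Data.List.Relation.Unary.All using (All)
open import Data.List.Relation.Unary.Linked using (Linked)
open import Relation.Binary.PropositionalEquality using (_≡_)
open import Relation.Nullary using (¬_)
import Data.List.Sort.MergeSort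
open import Data.List.Sort.Base using (SortingAlgorithm)

-- Conventions: tuples / permutations of length n are functions ℕ → ℕ,
-- used 1-based on the indices 1..n (values outside [n] are irrelevant).

sort : List ℕ → List ℕ
sort = SortingAlgorithm.sort (Data.List.Sort.MergeSort.mergeSort ≤-decTotalOrder)

range : ℕ → List ℕ
range m = map suc (upTo m)

interval : ℕ → ℕ → List ℕ
interval a b = map (a +_) (range (b ∸ a))

-- 0-based list lookup with default 0
nth0 : List ℕ → ℕ → ℕ
nth0 []       _       = 0
nth0 (x ∷ xs) zero    = x
nth0 (x ∷ xs) (suc k) = nth0 xs k

elemᵇ : ℕ → List ℕ → Bool
elemᵇ x xs = any (λ y → y ≡ᵇ x) xs

-- rank^d(Q): d-th largest element of Q (d ≥ 1)
rank : ℕ → List ℕ → ℕ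
rank d Q = nth0 (reverse (sort Q)) (d ∸ 1)

InRange : ℕ → ℕ → Set
InRange n i = 1 ≤ i × i ≤ n

-- The set R ⊆ [n-1], given as the list q₁ < ... < q_r

ValidR : ℕ → List ℕ → Set
ValidR n R = Linked _<_ R × All (λ q → 1 ≤ q × q < n) R

-- q_h with q₀ = 0, q_{r+1} = n
qq : ℕ → List ℕ → ℕ → ℕ
qq n R h = nth0 (0 ∷ R ++ (n ∷ [])) h

maxBelow : ℕ → List ℕ → ℕ
maxBelow i []       = 0
maxBelow i (q ∷ qs) = if q <ᵇ i then q ⊔ maxBelow i qs else maxBelow i qs

minAtLeast : ℕ → List ℕ → ℕ → ℕ
minAtLeast i []       d = d
minAtLeast i (q ∷ qs) d = if i ≤ᵇ q then q ⊓ minAtLeast i qs d else minAtLeast i qs d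

-- for i in carrel (q_{h-1}, q_h]:  cStart = q_{h-1}, cEnd = q_h
cStart : List ℕ → ℕ → ℕ
cStart R i = maxBelow i R

cEnd : ℕ → List ℕ → ℕ → ℕ
cEnd n R i = minAtLeast i R n

IsPerm : ℕ → (ℕ → ℕ) → Set
IsPerm n σ = (∀ i → InRange n i → InRange n (σ i))
           × (∀ i j → InRange n i → InRange n j → σ i ≡ σ j → i ≡ j)

Avoids312 : ℕ → (ℕ → ℕ) → Set
Avoids312 n σ = ¬ (∃[ a ] ∃[ b ] ∃[ c ]
  (1 ≤ a × a < b × b < c × c ≤ n × σ b < σ c × σ c < σ a))

-- length = number of inversions
inversions : ℕ → (ℕ → ℕ) → ℕ
inversions n σ = length (filter (λ p → σ (proj₂ p) <? σ (proj₁ p))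
  (concatMap (λ j → map (λ i → (i , j)) (range (j ∸ 1))) (range n)))

-- S_n^R : strictly increasing on each carrel
InSnR : ℕ → List ℕ → (ℕ → ℕ) → Set
InSnR n R π = IsPerm n π × (∀ i → 1 ≤ i → i < n → i ∉ R → π i < π (suc i))

R312Containing : ℕ → List ℕ → (ℕ → ℕ) → Set
R312Containing n R π = ∃[ h ] ∃[ a ] ∃[ b ] ∃[ c ]
  (1 ≤ h × h ≤ length R ∸ 1
   × 1 ≤ a × a ≤ qq n R h × qq n R h < b × b ≤ qq n R (suc h) × qq n R (suc h) < c × c ≤ n
   × π b < π c × π c < π a)

R312Avoiding : ℕ → List ℕ → (ℕ → ℕ) → Set
R312Avoiding n R π = ¬ R312Containing n R π

-- R-projection: sort the entries within each carrel increasingly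
projR : ℕ → List ℕ → (ℕ → ℕ) → (ℕ → ℕ)
projR n R σ i = nth0 (sort (map σ (interval (cStart R i) (cEnd n R i)))) (i ∸ cStart R i ∸ 1)

Ψ : (ℕ → ℕ) → (ℕ → ℕ)
Ψ σ i = foldr _⊔_ 0 (map σ (range i))

ΨR : ℕ → List ℕ → (ℕ → ℕ) → (ℕ → ℕ)
ΨR n R π i = rank (cEnd n R i ∸ i + 1) (map π (range (cEnd n R i)))

-- max([m] \ S), 0 if empty
maxNotIn : ℕ → List ℕ → ℕ
maxNotIn zero    S = 0
maxNotIn (suc m) S = if elemᵇ (suc m) S then maxNotIn m S else suc m

ΠList : (ℕ → ℕ) → ℕ → List ℕ
ΠList φ zero    = []
ΠList φ (suc k) = ΠList φ k ++ (maxNotIn (φ (suc k)) (ΠList φ k) ∷ [])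

Π : (ℕ → ℕ) → (ℕ → ℕ)
Π φ zero    = 0
Π φ (suc k) = maxNotIn (φ (suc k)) (ΠList φ k)

-- largest y with lo < y ≤ k and υ_x - υ_y > x - y
findBelow : (ℕ → ℕ) → ℕ → ℕ → ℕ → Maybe ℕ
findBelow υ lo x zero    = nothing
findBelow υ lo x (suc k) =
  if lo <ᵇ suc k
  then (if υ (suc k) + (x ∸ suc k) <ᵇ υ x then just (suc k) else findBelow υ lo x k)
  else nothing

-- x₁ = x, x₂, ... (fuel bounds the chain length)
critChain : (ℕ → ℕ) → ℕ → ℕ → ℕ → List ℕ
critChain υ lo x zero       = []
critChain υ lo x (suc fuel) =
  x ∷ maybe′ (λ y → critChain υ lo y fuel) [] (findBelow υ lo x (x ∸ 1))

critIndices : ℕ → List ℕ → (ℕ → ℕ) → ℕ → List ℕ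
critIndices n R υ i = critChain υ (cStart R i) (cEnd n R i) (cEnd n R i)

ΔR : ℕ → List ℕ → (ℕ → ℕ) → (ℕ → ℕ)
ΔR n R υ i = let x = minAtLeast i (critIndices n R υ i) (cEnd n R i) in υ x ∸ (x ∸ i)

ΦR : ℕ → List ℕ → (ℕ → ℕ) → (ℕ → ℕ)
ΦR n R γ i =
  let lo = cStart R i
      x  = foldr _⊓_ (cEnd n R i) (critIndices n R γ i)
  in if elemᵇ lo R ∧ (lo <ᵇ i) ∧ (i <ᵇ x) then γ lo ⊔ γ i else γ i

module Submission where

-- The proof studies σ one carrel (lo, e] at a time.
--  * Minimality: transposing an adjacent descent σ_{p+1} < σ_p inside a carrel
--    keeps the R-projection and removes exactly one inversion; when σ_p is a
--    left-to-right maximum it also keeps 312-avoidance.  So a left-to-right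
--    maximum inside a carrel is followed by another one, and the left-to-right
--    maxima in (lo, e] form a final segment (b, e].  On (lo, b] the prefix
--    maximum Ψ(σ) stays at M = Ψ(σ)_lo, and 312-avoidance forces σ to run
--    down through the values just below M.
--  * Ranks: {π_1..π_e} is a rearrangement of {σ_1..σ_e}, so Ψ_R(π)_j is the
--    (e-j+1)-st largest of σ_1..σ_e, which by the shape above is Ψ(σ)_j for
--    j ≥ b and M - (b - j) for j ≤ b.
--  * Cores: a tuple of this shape has all its critical indices in [b, e], and
--    its R-core takes exactly these values, so Δ_R(Ψ(σ)) = Ψ_R(π); likewise
--    Φ_R only raises the entries below b back to Ψ_R(π)_lo = M, so
--    Φ_R(Ψ_R(π)) = Ψ(σ), and Π inverts Ψ on 312-avoiding permutations.
-- The file develops: integer ranges, prefix maxima, permutations, sorting,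
-- inversions and adjacent transpositions, carrels and the minimality
-- consequence, the values of π on carrels, critical chains and the R-core of
-- a shaped tuple, the carrel shape of σ with the resulting ranks, Π ∘ Ψ = id,
-- and finally the theorem.

open import Defs
open import Data.Bool using (Bool; true; false; if_then_else_; T; _∧_)
open import Data.Bool.Properties using (T-≡)
open import Function.Bundles using (Equivalence)
open import Data.Maybe using (just; nothing)
open import Data.Nat
open import Data.Nat.Properties
open import Data.Nat.Induction using (<-rec)
open import Data.List using (List; []; _∷_; _++_; [_]; _∷ʳ_; map; upTo; applyUpTo; foldr; reverse; length; filter; concatMap)
open import Data.List.Properties
  using (map-++; ++-assoc; ++-identityʳ; ++-cancelˡ; upTo-∷ʳ; map-∘; map-cong-local; map-upTo; length-map; length-upTo;
         filter-++; length-++; unfold-reverse)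
open import Data.Nat.ListAction using (sum)
open import Data.Nat.ListAction.Properties using (sum-++)
open import Data.List.Membership.Propositional using (_∈_; _∉_)
open import Data.List.Membership.Propositional.Properties using (∈-map⁺; ∈-map⁻; ∈-++⁺ˡ; ∈-++⁺ʳ; ∈-++⁻)
open import Data.List.Relation.Unary.Any as Any using (here; there)
open import Data.List.Relation.Unary.Any.Properties using (any⁺; any⁻)
open import Data.List.Relation.Unary.All as All using (All; []; _∷_)
open import Data.List.Relation.Unary.AllPairs.Properties using () renaming (++⁺ to AllPairs-++⁺)
open import Data.List.Relation.Unary.AllPairs as AllPairs using (AllPairs; []; _∷_)
open import Data.List.Relation.Binary.Permutation.Propositional
  using (_↭_; swap; ↭-refl; ↭-sym; ↭-trans; ↭-reflexive; ↭⇒↭ₛ)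
open import Data.List.Relation.Binary.Permutation.Propositional.Properties
  using (All-resp-↭; ∈-resp-↭; ↭-reverse; ++⁺ˡ; ++⁺ʳ; ↭-length)
import Data.List.Relation.Binary.Permutation.Homogeneous as Homogeneous
open import Data.List.Relation.Binary.Pointwise using (Pointwise-≡⇒≡)
open import Data.List.Sort.Base using (SortingAlgorithm)
import Data.List.Sort.MergeSort
open import Data.List.Relation.Unary.Sorted.TotalOrder.Properties using (↗↭↗⇒≋; Sorted⇒AllPairs)
open import Relation.Binary.Definitions using (tri<; tri≈; tri>)
open import Data.Product using (_×_; _,_; proj₁; proj₂; ∃-syntax)
open import Data.Sum using (_⊎_; inj₁; inj₂)
open import Data.Empty using (⊥-elim)
open import Relation.Nullary using (¬_; yes; no; Dec; does; _×-dec_)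
open import Relation.Binary.PropositionalEquality
  using (_≡_; _≢_; refl; sym; trans; cong; cong₂; subst; subst₂; resp₂; ≢-sym; setoid; module ≡-Reasoning)
import Data.List.Relation.Binary.Permutation.Setoid.Properties (setoid ℕ) as ↭ₛ

range-suc : ∀ m → range (suc m) ≡ range m ∷ʳ suc m
range-suc m = trans (cong (map suc) (sym (upTo-∷ʳ m))) (map-++ suc (upTo m) [ m ])

range-+ : ∀ a d → range (a + d) ≡ range a ++ map (a +_) (range d)
range-+ a zero = trans (cong range (+-identityʳ a)) (sym (++-identityʳ (range a)))
range-+ a (suc d) = begin
  range (a + suc d)                                     ≡⟨ cong range (+-suc a d) ⟩
  range (suc (a + d))                                   ≡⟨ range-suc (a + d) ⟩
  range (a + d) ∷ʳ suc (a + d)                          ≡⟨ cong (_∷ʳ suc (a + d)) (range-+ a d) ⟩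
  (range a ++ map (a +_) (range d)) ∷ʳ suc (a + d)      ≡⟨ ++-assoc (range a) _ _ ⟩
  range a ++ (map (a +_) (range d) ∷ʳ suc (a + d))      ≡⟨ cong (λ z → range a ++ (map (a +_) (range d) ∷ʳ z)) (sym (+-suc a d)) ⟩
  range a ++ (map (a +_) (range d) ∷ʳ (a + suc d))      ≡⟨ cong (range a ++_) (sym (map-++ (a +_) (range d) [ suc d ])) ⟩
  range a ++ map (a +_) (range d ∷ʳ suc d)              ≡⟨ cong (λ z → range a ++ map (a +_) z) (sym (range-suc d)) ⟩
  range a ++ map (a +_) (range (suc d))                 ∎
  where open ≡-Reasoning

range-split : ∀ a b → a ≤ b → range b ≡ range a ++ interval a b
range-split a b a≤b = trans (cong range (sym (m+[n∸m]≡n a≤b))) (range-+ a (b ∸ a))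

interval-+ : ∀ a d → interval a (a + d) ≡ map (a +_) (range d)
interval-+ a d = cong (λ z → map (a +_) (range z)) (m+n∸m≡n a d)

interval-split : ∀ a m b → a ≤ m → m ≤ b → interval a b ≡ interval a m ++ interval m b
interval-split a m b a≤m m≤b = ++-cancelˡ (range a) _ _ (begin
  range a ++ interval a b                 ≡⟨ sym (range-split a b (≤-trans a≤m m≤b)) ⟩
  range b                                 ≡⟨ range-split m b m≤b ⟩
  range m ++ interval m b                 ≡⟨ cong (_++ interval m b) (range-split a m a≤m) ⟩
  (range a ++ interval a m) ++ interval m b ≡⟨ ++-assoc (range a) _ _ ⟩
  range a ++ (interval a m ++ interval m b) ∎)
  where open ≡-Reasoning

interval-pair : ∀ a → interval a (suc (suc a)) ≡ suc a ∷ suc (suc a) ∷ []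
interval-pair a = trans (cong (interval a) (+-comm 2 a)) (trans (interval-+ a 2)
  (cong₂ (λ u v → u ∷ v ∷ []) (+-comm a 1) (+-comm a 2)))

length-interval : ∀ a b → length (interval a b) ≡ b ∸ a
length-interval a b = trans (length-map (a +_) (range (b ∸ a)))
  (trans (length-map suc (upTo (b ∸ a))) (length-upTo (b ∸ a)))

∈range⁻ : ∀ {x} m → x ∈ range m → 1 ≤ x × x ≤ m
∈range⁻ zero ()
∈range⁻ (suc m) x∈ rewrite range-suc m with ∈-++⁻ (range m) x∈
... | inj₁ x∈m = proj₁ (∈range⁻ m x∈m) , m≤n⇒m≤1+n (proj₂ (∈range⁻ m x∈m))
... | inj₂ (here refl) = s≤s z≤n , ≤-refl

∈range⁺ : ∀ {x} m → 1 ≤ x → x ≤ m → x ∈ range m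
∈range⁺ zero 1≤x x≤m = ⊥-elim (<⇒≱ 1≤x x≤m)
∈range⁺ (suc m) 1≤x x≤m rewrite range-suc m with m≤n⇒m<n∨m≡n x≤m
... | inj₁ x<m = ∈-++⁺ˡ (∈range⁺ m 1≤x (≤-pred x<m))
... | inj₂ refl = ∈-++⁺ʳ (range m) (here refl)

∈interval⁻ : ∀ {x} a b → x ∈ interval a b → a < x × x ≤ b
∈interval⁻ a b x∈ with ∈-map⁻ (a +_) x∈
... | y , y∈ , refl with ∈range⁻ (b ∸ a) y∈
... | 1≤y , y≤b∸a = m<m+n a 1≤y , ≤-trans (+-monoʳ-≤ a y≤b∸a) (≤-reflexive (m+[n∸m]≡n a≤b))
  where
  a≤b : a ≤ b
  a≤b = <⇒≤ (m∸n≢0⇒n<m (λ b∸a≡0 → <⇒≢ (≤-trans 1≤y y≤b∸a) (sym b∸a≡0)))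

map-cong-∈ : ∀ (f g : ℕ → ℕ) xs → (∀ x → x ∈ xs → f x ≡ g x) → map f xs ≡ map g xs
map-cong-∈ f g xs f≡g = map-cong-local (All.tabulate (λ {x} x∈ → f≡g x x∈))

foldr-⊔-∷ʳ : ∀ (xs : List ℕ) y → foldr _⊔_ 0 (xs ∷ʳ y) ≡ foldr _⊔_ 0 xs ⊔ y
foldr-⊔-∷ʳ [] y = trans (⊔-identityʳ y) (sym (⊔-identityˡ y))
foldr-⊔-∷ʳ (x ∷ xs) y = trans (cong (x ⊔_) (foldr-⊔-∷ʳ xs y)) (sym (⊔-assoc x _ y))

Ψ-suc : ∀ σ i → Ψ σ (suc i) ≡ Ψ σ i ⊔ σ (suc i)
Ψ-suc σ i = begin
  foldr _⊔_ 0 (map σ (range (suc i)))          ≡⟨ cong (λ l → foldr _⊔_ 0 (map σ l)) (range-suc i) ⟩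
  foldr _⊔_ 0 (map σ (range i ∷ʳ suc i))       ≡⟨ cong (foldr _⊔_ 0) (map-++ σ (range i) [ suc i ]) ⟩
  foldr _⊔_ 0 (map σ (range i) ∷ʳ σ (suc i))   ≡⟨ foldr-⊔-∷ʳ (map σ (range i)) (σ (suc i)) ⟩
  Ψ σ i ⊔ σ (suc i)                             ∎
  where open ≡-Reasoning

Ψ-upper : ∀ σ i a → 1 ≤ a → a ≤ i → σ a ≤ Ψ σ i
Ψ-upper σ zero a 1≤a a≤0 = ⊥-elim (<⇒≱ 1≤a a≤0)
Ψ-upper σ (suc i) a 1≤a a≤i+1 rewrite Ψ-suc σ i with m≤n⇒m<n∨m≡n a≤i+1
... | inj₁ a≤i = ≤-trans (Ψ-upper σ i a 1≤a (≤-pred a≤i)) (m≤m⊔n _ _)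
... | inj₂ refl = m≤n⊔m _ _

Ψ-attained : ∀ σ i → 1 ≤ i → ∃[ a ] (1 ≤ a × a ≤ i × Ψ σ i ≡ σ a)
Ψ-attained σ (suc i) _ = attained i
  where
  attained : ∀ i → ∃[ a ] (1 ≤ a × a ≤ suc i × Ψ σ (suc i) ≡ σ a)
  attained zero = 1 , ≤-refl , ≤-refl , ⊔-identityʳ (σ 1)
  attained (suc i) with ≤-total (Ψ σ (suc i)) (σ (suc (suc i))) | attained i
  ... | inj₁ Ψ≤σ | _ = suc (suc i) , s≤s z≤n , ≤-refl , trans (Ψ-suc σ (suc i)) (m≤n⇒m⊔n≡n Ψ≤σ)
  ... | inj₂ σ≤Ψ | a , 1≤a , a≤i , Ψ≡σa =
    a , 1≤a , m≤n⇒m≤1+n a≤i , trans (Ψ-suc σ (suc i)) (trans (m≥n⇒m⊔n≡m σ≤Ψ) Ψ≡σa)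

Ψ-mono : ∀ σ i j → i ≤ j → Ψ σ i ≤ Ψ σ j
Ψ-mono σ i zero z≤n = ≤-refl
Ψ-mono σ i (suc j) i≤j+1 with m≤n⇒m<n∨m≡n i≤j+1
... | inj₁ i≤j = ≤-trans (Ψ-mono σ i j (≤-pred i≤j)) (subst (Ψ σ j ≤_) (sym (Ψ-suc σ j)) (m≤m⊔n _ _))
... | inj₂ refl = ≤-refl

perm-range : ∀ {n σ i} → IsPerm n σ → InRange n i → InRange n (σ i)
perm-range (maps , _) = maps _

perm-inj : ∀ {n σ i j} → IsPerm n σ → InRange n i → InRange n j → σ i ≡ σ j → i ≡ j
perm-inj (_ , inj) = inj _ _

dropTop : (ℕ → ℕ) → ℕ → ℕ → ℕ
dropTop σ N i with σ i ≟ N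
... | yes _ = σ N
... | no _  = σ i

dropTop-cases : ∀ σ N i → (σ i ≡ N × dropTop σ N i ≡ σ N) ⊎ (σ i ≢ N × dropTop σ N i ≡ σ i)
dropTop-cases σ N i with σ i ≟ N
... | yes σi≡N = inj₁ (σi≡N , refl)
... | no σi≢N  = inj₂ (σi≢N , refl)

dropTop-perm : ∀ n σ → IsPerm (suc n) σ → IsPerm n (dropTop σ (suc n))
dropTop-perm n σ p = maps , inj
  where
  N : ℕ
  N = suc n
  lift : ∀ {i} → InRange n i → InRange N i
  lift (1≤i , i≤n) = 1≤i , m≤n⇒m≤1+n i≤n
  top : InRange N N
  top = s≤s z≤n , ≤-refl
  below : ∀ {x} → x ≤ N → x ≢ N → x ≤ n
  below x≤N x≢N with m≤n⇒m<n∨m≡n x≤N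
  ... | inj₁ x<N = ≤-pred x<N
  ... | inj₂ x≡N = ⊥-elim (x≢N x≡N)
  i≢N : ∀ {i} → InRange n i → i ≢ N
  i≢N (_ , i≤n) refl = <-irrefl refl (s≤s i≤n)
  maps : ∀ i → InRange n i → InRange n (dropTop σ N i)
  maps i ri with dropTop-cases σ N i
  ... | inj₁ (σi≡N , d≡) = subst (InRange n) (sym d≡)
        (proj₁ (perm-range p top) , below (proj₂ (perm-range p top))
          (λ σN≡N → i≢N ri (perm-inj p (lift ri) top (trans σi≡N (sym σN≡N)))))
  ... | inj₂ (σi≢N , d≡) = subst (InRange n) (sym d≡)
        (proj₁ (perm-range p (lift ri)) , below (proj₂ (perm-range p (lift ri))) σi≢N)
  inj : ∀ i j → InRange n i → InRange n j → dropTop σ N i ≡ dropTop σ N j → i ≡ j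
  inj i j ri rj eq with dropTop-cases σ N i | dropTop-cases σ N j
  ... | inj₁ (σi , _) | inj₁ (σj , _) = perm-inj p (lift ri) (lift rj) (trans σi (sym σj))
  ... | inj₁ (_ , di) | inj₂ (_ , dj) = ⊥-elim (i≢N rj (sym (perm-inj p top (lift rj) (trans (sym di) (trans eq dj)))))
  ... | inj₂ (_ , di) | inj₁ (_ , dj) = ⊥-elim (i≢N ri (perm-inj p (lift ri) top (trans (sym di) (trans eq dj))))
  ... | inj₂ (_ , di) | inj₂ (_ , dj) = perm-inj p (lift ri) (lift rj) (trans (sym di) (trans eq dj))

perm-surjective : ∀ n σ → IsPerm n σ → ∀ v → InRange n v → ∃[ c ] (InRange n c × σ c ≡ v)
perm-surjective zero σ p v (1≤v , v≤0) = ⊥-elim (<⇒≱ 1≤v v≤0)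
perm-surjective (suc n) σ p v (1≤v , v≤N) = hit (m≤n⇒m<n∨m≡n v≤N)
  where
  N : ℕ
  N = suc n
  top : InRange N N
  top = s≤s z≤n , ≤-refl
  lift : ∀ {i} → InRange n i → InRange N i
  lift (1≤i , i≤n) = 1≤i , m≤n⇒m≤1+n i≤n
  hit-by-dropTop : ∀ w → InRange n w → ∃[ c ] (InRange n c × dropTop σ N c ≡ w)
  hit-by-dropTop = perm-surjective n (dropTop σ N) (dropTop-perm n σ p)
  pullback : ∀ {w} → ∃[ c ] (InRange n c × dropTop σ N c ≡ w) → ∃[ c ] (InRange N c × σ c ≡ w)
  pullback (c , rc , dc≡w) with dropTop-cases σ N c
  ... | inj₁ (_ , dc≡σN) = N , top , trans (sym dc≡σN) dc≡w
  ... | inj₂ (_ , dc≡σc) = c , lift rc , trans (sym dc≡σc) dc≡w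
  hit : v < N ⊎ v ≡ N → ∃[ c ] (InRange N c × σ c ≡ v)
  hit (inj₁ v<N) = pullback (hit-by-dropTop v (1≤v , ≤-pred v<N))
  hit (inj₂ refl) with σ N ≟ N
  ... | yes σN≡N = N , top , σN≡N
  ... | no σN≢N with hit-by-dropTop (σ N) σN∈[n]
    where
    σN∈[n] : InRange n (σ N)
    σN∈[n] with perm-range p top
    ... | 1≤σN , σN≤N = 1≤σN , ≤-pred (≤∧≢⇒< σN≤N σN≢N)
  ...   | c , rc , dc≡σN with dropTop-cases σ N c
  ...     | inj₁ (σc≡N , _) = c , lift rc , σc≡N
  ...     | inj₂ (_ , dc≡σc) =
    ⊥-elim (<-irrefl (perm-inj p (lift rc) top (trans (sym dc≡σc) dc≡σN)) (s≤s (proj₂ rc)))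

AllPairs-∷ʳ : ∀ {R : ℕ → ℕ → Set} {xs x} → AllPairs R xs → All (λ y → R y x) xs → AllPairs R (xs ∷ʳ x)
AllPairs-∷ʳ pairs new = AllPairs-++⁺ pairs ([] ∷ []) (All.map (_∷ []) new)

Distinct : List ℕ → Set
Distinct = AllPairs _≢_

distinct-prefix : ∀ n σ → IsPerm n σ → ∀ e → e ≤ n → Distinct (map σ (range e))
distinct-prefix n σ p zero e≤n = []
distinct-prefix n σ p (suc e) e≤n =
  subst Distinct (sym (trans (cong (map σ) (range-suc e)) (map-++ σ (range e) [ suc e ])))
    (AllPairs-∷ʳ (distinct-prefix n σ p e (≤-trans (n≤1+n e) e≤n)) (All.tabulate new))
  where
  new : ∀ {x} → x ∈ map σ (range e) → x ≢ σ (suc e)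
  new x∈ x≡ with ∈-map⁻ σ x∈
  ... | c , c∈ , refl with ∈range⁻ e c∈
  ... | 1≤c , c≤e = <⇒≢ (s≤s c≤e) (perm-inj p (1≤c , ≤-trans c≤e (≤-trans (n≤1+n e) e≤n)) (s≤s z≤n , e≤n) x≡)

mergeSort : SortingAlgorithm ≤-totalOrder
mergeSort = Data.List.Sort.MergeSort.mergeSort ≤-decTotalOrder

sort-↭ : ∀ xs → sort xs ↭ xs
sort-↭ = SortingAlgorithm.sort-↭ mergeSort

sort-resp-↭ : ∀ {xs ys} → xs ↭ ys → sort xs ≡ sort ys
sort-resp-↭ {xs} {ys} xs↭ys = Pointwise-≡⇒≡ (↗↭↗⇒≋ ≤-totalOrder
  (SortingAlgorithm.sort-↗ mergeSort xs) (SortingAlgorithm.sort-↗ mergeSort ys)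
  (Homogeneous.map (λ eq → eq) (↭⇒↭ₛ (↭-trans (sort-↭ xs) (↭-trans xs↭ys (↭-sym (sort-↭ ys)))))))

distinct-resp-↭ : ∀ {xs ys} → xs ↭ ys → Distinct xs → Distinct ys
distinct-resp-↭ xs↭ys = ↭ₛ.AllPairs-resp-↭ ≢-sym (resp₂ _≢_) (↭⇒↭ₛ xs↭ys)

descending : List ℕ → List ℕ
descending Q = reverse (sort Q)

descending-↭ : ∀ Q → descending Q ↭ Q
descending-↭ Q = ↭-trans (↭-reverse (sort Q)) (sort-↭ Q)

reverse-increasing : ∀ {xs} → AllPairs _<_ xs → AllPairs _>_ (reverse xs)
reverse-increasing {[]} [] = []
reverse-increasing {x ∷ xs} (x< ∷ inc) = subst (AllPairs _>_) (sym (unfold-reverse x xs))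
  (AllPairs-∷ʳ (reverse-increasing inc) (All-resp-↭ (↭-sym (↭-reverse xs)) x<))

descending-strict : ∀ Q → Distinct Q → AllPairs _>_ (descending Q)
descending-strict Q d = reverse-increasing (AllPairs.zipWith (λ (x≤y , x≢y) → ≤∧≢⇒< x≤y x≢y)
  (Sorted⇒AllPairs ≤-totalOrder (SortingAlgorithm.sort-↗ mergeSort Q) , distinct-resp-↭ (↭-sym (sort-↭ Q)) d))

-- a nonzero entry read by nth0 is a member (nth0 returns 0 out of range)
nth0-∈ : ∀ L j → 0 < nth0 L j → nth0 L j ∈ L
nth0-∈ [] j ()
nth0-∈ (x ∷ L) zero _ = here refl
nth0-∈ (x ∷ L) (suc j) pos = there (nth0-∈ L j pos)

nth0-head : ∀ D v → AllPairs _>_ D → v ∈ D → (∀ w → w ∈ D → w ≤ v) → nth0 D 0 ≡ v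
nth0-head (x ∷ D) v dec (here refl) _ = refl
nth0-head (x ∷ D) v (x> ∷ _) (there v∈) max = ⊥-elim (<⇒≱ (All.lookup x> v∈) (max x (here refl)))

nth0-next : ∀ D j v w → AllPairs _>_ D → nth0 D j ≡ v → w ∈ D → w < v → (∀ u → u ∈ D → u < v → u ≤ w)
  → nth0 D (suc j) ≡ w
nth0-next (x ∷ D) zero v w dec refl (here refl) w<v _ = ⊥-elim (<-irrefl refl w<v)
nth0-next (x ∷ y ∷ D) zero v w (x> ∷ dec) refl (there w∈) w<v max =
  ≤-antisym (max y (there (here refl)) (All.lookup x> (here refl))) (below-head w∈)
  where
  below-head : w ∈ (y ∷ D) → w ≤ y
  below-head (here refl) = ≤-refl
  below-head (there w∈D) = <⇒≤ (All.lookup (AllPairs.head dec) w∈D)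
nth0-next (x ∷ D) (suc j) v w (x> ∷ dec) Dj≡v w∈ w<v max =
  nth0-next D j v w dec Dj≡v (drop-head w∈) w<v (λ u u∈ → max u (there u∈))
  where
  drop-head : w ∈ (x ∷ D) → w ∈ D
  drop-head (there w∈D) = w∈D
  drop-head (here refl) = ⊥-elim (<-asym w<v (All.lookup x> (subst (_∈ D) Dj≡v (nth0-∈ D j (subst (0 <_) (sym Dj≡v) (≤-<-trans z≤n w<v))))))

sumTo : (ℕ → ℕ) → ℕ → ℕ
sumTo f zero = 0
sumTo f (suc m) = sumTo f m + f (suc m)

sum-range : ∀ f m → sum (map f (range m)) ≡ sumTo f m
sum-range f zero = refl
sum-range f (suc m) = begin
  sum (map f (range (suc m)))          ≡⟨ cong (λ l → sum (map f l)) (range-suc m) ⟩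
  sum (map f (range m ∷ʳ suc m))       ≡⟨ cong sum (map-++ f (range m) [ suc m ]) ⟩
  sum (map f (range m) ∷ʳ f (suc m))   ≡⟨ sum-++ (map f (range m)) [ f (suc m) ] ⟩
  sum (map f (range m)) + (f (suc m) + 0) ≡⟨ cong₂ _+_ (sum-range f m) (+-identityʳ (f (suc m))) ⟩
  sumTo f m + f (suc m)                ∎
  where open ≡-Reasoning

sumTo-cong : ∀ f g m → (∀ i → 1 ≤ i → i ≤ m → f i ≡ g i) → sumTo f m ≡ sumTo g m
sumTo-cong f g zero _ = refl
sumTo-cong f g (suc m) f≡g =
  cong₂ _+_ (sumTo-cong f g m (λ i 1≤i i≤m → f≡g i 1≤i (m≤n⇒m≤1+n i≤m))) (f≡g (suc m) (s≤s z≤n) ≤-refl)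

indicator : ∀ {P : Set} → Dec P → ℕ
indicator (yes _) = 1
indicator (no _)  = 0

largerBefore : (ℕ → ℕ) → ℕ → ℕ → ℕ
largerBefore σ j m = sumTo (λ i → indicator (σ j <? σ i)) m

inversionSum : (ℕ → ℕ) → ℕ → ℕ
inversionSum σ = sumTo (λ j → largerBefore σ j (j ∸ 1))

length-filter-∷ʳ : ∀ {A : Set} {P : A → Set} (P? : ∀ a → Dec (P a)) xs y →
  length (filter P? (xs ∷ʳ y)) ≡ length (filter P? xs) + indicator (P? y)
length-filter-∷ʳ P? xs y rewrite filter-++ P? xs [ y ] | length-++ (filter P? xs) {filter P? [ y ]} with P? y
... | yes _ = refl
... | no _  = refl

inversions≡inversionSum : ∀ n σ → inversions n σ ≡ inversionSum σ n
inversions≡inversionSum n σ = trans (count-columns (range n)) (sum-range (λ j → largerBefore σ j (j ∸ 1)) n)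
  where
  inverted? : ∀ (p : ℕ × ℕ) → Dec (σ (proj₂ p) < σ (proj₁ p))
  inverted? = λ (p : ℕ × ℕ) → σ (proj₂ p) <? σ (proj₁ p)
  column : ℕ → List (ℕ × ℕ)
  column j = map (λ i → (i , j)) (range (j ∸ 1))
  count-list : ∀ j L → length (filter inverted? (map (λ i → (i , j)) L)) ≡ length (filter (λ i → σ j <? σ i) L)
  count-list j [] = refl
  count-list j (i ∷ L) with does (σ j <? σ i)
  ... | true  = cong suc (count-list j L)
  ... | false = count-list j L
  count-prefix : ∀ j m → length (filter (λ i → σ j <? σ i) (range m)) ≡ largerBefore σ j m
  count-prefix j zero = refl
  count-prefix j (suc m) = begin
    length (filter (λ i → σ j <? σ i) (range (suc m)))
      ≡⟨ cong (λ l → length (filter (λ i → σ j <? σ i) l)) (range-suc m) ⟩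
    length (filter (λ i → σ j <? σ i) (range m ∷ʳ suc m))
      ≡⟨ length-filter-∷ʳ (λ i → σ j <? σ i) (range m) (suc m) ⟩
    length (filter (λ i → σ j <? σ i) (range m)) + indicator (σ j <? σ (suc m))
      ≡⟨ cong (_+ indicator (σ j <? σ (suc m))) (count-prefix j m) ⟩
    largerBefore σ j (suc m) ∎
    where open ≡-Reasoning
  count-columns : ∀ L → length (filter inverted? (concatMap column L)) ≡ sum (map (λ j → largerBefore σ j (j ∸ 1)) L)
  count-columns [] = refl
  count-columns (j ∷ L) = begin
    length (filter inverted? (column j ++ concatMap column L))
      ≡⟨ cong length (filter-++ inverted? (column j) _) ⟩
    length (filter inverted? (column j) ++ filter inverted? (concatMap column L))
      ≡⟨ length-++ (filter inverted? (column j)) ⟩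
    length (filter inverted? (column j)) + length (filter inverted? (concatMap column L))
      ≡⟨ cong₂ _+_ (trans (count-list j (range (j ∸ 1))) (count-prefix j (j ∸ 1))) (count-columns L) ⟩
    largerBefore σ j (j ∸ 1) + sum (map (λ j → largerBefore σ j (j ∸ 1)) L) ∎
    where open ≡-Reasoning

transpose : ℕ → ℕ → ℕ
transpose p i with i ≟ p | i ≟ suc p
... | yes _ | _     = suc p
... | no _  | yes _ = p
... | no _  | no _  = i

transpose-p : ∀ p → transpose p p ≡ suc p
transpose-p p with p ≟ p
... | yes _  = refl
... | no p≢p = ⊥-elim (p≢p refl)

transpose-p+1 : ∀ p → transpose p (suc p) ≡ p
transpose-p+1 p with suc p ≟ p | suc p ≟ suc p
... | yes p+1≡p | _ = ⊥-elim (<⇒≢ (n<1+n p) (sym p+1≡p))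
... | no _ | yes _  = refl
... | no _ | no ≢   = ⊥-elim (≢ refl)

transpose-other : ∀ p i → i ≢ p → i ≢ suc p → transpose p i ≡ i
transpose-other p i i≢p i≢p+1 with i ≟ p | i ≟ suc p
... | yes i≡p | _ = ⊥-elim (i≢p i≡p)
... | no _ | yes i≡p+1 = ⊥-elim (i≢p+1 i≡p+1)
... | no _ | no _ = refl

transpose-before : ∀ p i → i < p → transpose p i ≡ i
transpose-before p i i<p = transpose-other p i (<⇒≢ i<p) (<⇒≢ (m<n⇒m<1+n i<p))

transpose-after : ∀ p i → suc p < i → transpose p i ≡ i
transpose-after p i p+1<i = transpose-other p i (λ i≡p → <⇒≢ (<-trans (n<1+n p) p+1<i) (sym i≡p)) (λ i≡p+1 → <⇒≢ p+1<i (sym i≡p+1))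

data Position (p i : ℕ) : Set where
  at-p    : i ≡ p → Position p i
  at-p+1  : i ≡ suc p → Position p i
  before  : i < p → Position p i
  after   : suc p < i → Position p i

position : ∀ p i → Position p i
position p i with <-cmp i p
... | tri< i<p _ _ = before i<p
... | tri≈ _ i≡p _ = at-p i≡p
... | tri> _ _ p<i with <-cmp i (suc p)
...   | tri< i<p+1 _ _ = ⊥-elim (<⇒≱ p<i (≤-pred i<p+1))
...   | tri≈ _ i≡p+1 _ = at-p+1 i≡p+1
...   | tri> _ _ p+1<i = after p+1<i

transpose-involutive : ∀ p i → transpose p (transpose p i) ≡ i
transpose-involutive p i with position p i
... | at-p refl   = trans (cong (transpose p) (transpose-p p)) (transpose-p+1 p)
... | at-p+1 refl = trans (cong (transpose p) (transpose-p+1 p)) (transpose-p p)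
... | before i<p  = trans (cong (transpose p) (transpose-before p i i<p)) (transpose-before p i i<p)
... | after p+1<i = trans (cong (transpose p) (transpose-after p i p+1<i)) (transpose-after p i p+1<i)

transpose-range : ∀ p n i → 1 ≤ p → suc p ≤ n → InRange n i → InRange n (transpose p i)
transpose-range p n i 1≤p p+1≤n ri with position p i
... | at-p refl   = subst (InRange n) (sym (transpose-p p)) (s≤s z≤n , p+1≤n)
... | at-p+1 refl = subst (InRange n) (sym (transpose-p+1 p)) (1≤p , ≤-trans (n≤1+n p) p+1≤n)
... | before i<p  = subst (InRange n) (sym (transpose-before p i i<p)) ri
... | after p+1<i = subst (InRange n) (sym (transpose-after p i p+1<i)) ri

transpose-mono : ∀ p x y → x < y → ¬ (x ≡ p × y ≡ suc p) → transpose p x < transpose p y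
transpose-mono p x y x<y not-pair with position p x | position p y
... | at-p refl   | at-p refl   = ⊥-elim (<-irrefl refl x<y)
... | at-p refl   | at-p+1 refl = ⊥-elim (not-pair (refl , refl))
... | at-p refl   | before y<p  = ⊥-elim (<-asym x<y y<p)
... | at-p refl   | after p+1<y rewrite transpose-p p | transpose-after p y p+1<y = p+1<y
... | at-p+1 refl | at-p refl   = ⊥-elim (<-asym x<y (n<1+n p))
... | at-p+1 refl | at-p+1 refl = ⊥-elim (<-irrefl refl x<y)
... | at-p+1 refl | before y<p  = ⊥-elim (<-asym x<y (<-trans y<p (n<1+n p)))
... | at-p+1 refl | after p+1<y rewrite transpose-p+1 p | transpose-after p y p+1<y = <-trans (n<1+n p) p+1<y
... | before x<p  | at-p refl   rewrite transpose-before p x x<p | transpose-p p = <-trans x<p (n<1+n p)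
... | before x<p  | at-p+1 refl rewrite transpose-before p x x<p | transpose-p+1 p = x<p
... | before x<p  | before y<p  rewrite transpose-before p x x<p | transpose-before p y y<p = x<y
... | before x<p  | after p+1<y rewrite transpose-before p x x<p | transpose-after p y p+1<y = x<y
... | after p+1<x | at-p refl   = ⊥-elim (<-asym x<y (<-trans (n<1+n p) p+1<x))
... | after p+1<x | at-p+1 refl = ⊥-elim (<-asym x<y p+1<x)
... | after p+1<x | before y<p  = ⊥-elim (<-asym x<y (<-trans y<p (<-trans (n<1+n p) p+1<x)))
... | after p+1<x | after p+1<y rewrite transpose-after p x p+1<x | transpose-after p y p+1<y = x<y

sumTo-transpose : ∀ f p m → 1 ≤ p → suc p ≤ m → sumTo (λ i → f (transpose p i)) m ≡ sumTo f m
sumTo-transpose f (suc p) (suc m) _ p+1≤m+1 with m≤n⇒m<n∨m≡n p+1≤m+1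
... | inj₁ p+1<m+1 = cong₂ _+_ (sumTo-transpose f (suc p) m (s≤s z≤n) (≤-pred p+1<m+1))
                               (cong f (transpose-after (suc p) (suc m) p+1<m+1))
... | inj₂ refl = begin
  sumTo (λ i → f (transpose q i)) p + f (transpose q q) + f (transpose q (suc q))
    ≡⟨ cong₂ (λ a b → a + b + f (transpose q (suc q)))
         (sumTo-cong _ _ p (λ i _ i≤p → cong f (transpose-before q i (s≤s i≤p)))) (cong f (transpose-p q)) ⟩
  sumTo f p + f (suc q) + f (transpose q (suc q))
    ≡⟨ cong (λ z → sumTo f p + f (suc q) + f z) (transpose-p+1 q) ⟩
  sumTo f p + f (suc q) + f q
    ≡⟨ +-assoc (sumTo f p) _ _ ⟩
  sumTo f p + (f (suc q) + f q)
    ≡⟨ cong (sumTo f p +_) (+-comm (f (suc q)) _) ⟩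
  sumTo f p + (f q + f (suc q))
    ≡⟨ sym (+-assoc (sumTo f p) _ _) ⟩
  sumTo f p + f q + f (suc q) ∎
  where
  q : ℕ
  q = suc p
  open ≡-Reasoning

indicator-< : ∀ x y → x < y → indicator (x <? y) ≡ 1
indicator-< x y x<y with x <? y
... | yes _   = refl
... | no x≮y  = ⊥-elim (x≮y x<y)

indicator-≥ : ∀ x y → y ≤ x → indicator (x <? y) ≡ 0
indicator-≥ x y y≤x with x <? y
... | yes x<y = ⊥-elim (<⇒≱ x<y y≤x)
... | no _    = refl

inversionSum-cong : ∀ σ τ N → (∀ i → 1 ≤ i → i ≤ N → τ i ≡ σ i) → inversionSum τ N ≡ inversionSum σ N
inversionSum-cong σ τ N τ≡σ = sumTo-cong _ _ N (λ j 1≤j j≤N → sumTo-cong _ _ (j ∸ 1) (λ i 1≤i i≤j-1 →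
  cong₂ (λ u v → indicator (u <? v)) (τ≡σ j 1≤j j≤N) (τ≡σ i 1≤i (≤-trans i≤j-1 (≤-trans (m∸n≤m j 1) j≤N)))))

inversionSum-transpose : ∀ σ p n → 1 ≤ p → suc p ≤ n → σ (suc p) < σ p
  → inversionSum σ n ≡ suc (inversionSum (λ i → σ (transpose p i)) n)
inversionSum-transpose σ (suc p′) n _ p+1≤n descent = columns n p+1≤n
  where
  p : ℕ
  p = suc p′
  τ : ℕ → ℕ
  τ = λ i → σ (transpose p i)
  A : ℕ
  A = largerBefore σ (suc p) p′
  B : ℕ
  B = largerBefore σ p p′
  τ-before : ∀ i → 1 ≤ i → i ≤ p′ → σ (transpose p i) ≡ σ i
  τ-before i _ i≤p′ = cong σ (transpose-before p i (s≤s i≤p′))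
  A-τ : A ≡ largerBefore τ p p′
  A-τ = sumTo-cong _ _ p′ (λ i _ i≤p′ →
    cong₂ (λ u v → indicator (σ u <? σ v)) (sym (transpose-p p)) (sym (transpose-before p i (s≤s i≤p′))))
  B-τ : B + 0 ≡ largerBefore τ (suc p) p
  B-τ = cong₂ _+_
    (sumTo-cong _ _ p′ (λ i _ i≤p′ →
      cong₂ (λ u v → indicator (σ u <? σ v)) (sym (transpose-p+1 p)) (sym (transpose-before p i (s≤s i≤p′)))))
    (trans (sym (indicator-≥ _ _ (<⇒≤ descent)))
      (cong₂ (λ u v → indicator (σ u <? σ v)) (sym (transpose-p+1 p)) (sym (transpose-p p))))
  rearrange : ∀ x a b → x + b + (a + 1) ≡ suc (x + a + (b + 0))
  rearrange x a b rewrite +-identityʳ b | +-comm a 1 | +-suc (x + b) a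
    | +-assoc x b a | +-comm b a | +-assoc x a b = refl
  -- the columns p and p+1 carry the difference
  up-to-p+1 : inversionSum σ (suc p) ≡ suc (inversionSum τ (suc p))
  up-to-p+1 = begin
    inversionSum σ p′ + B + (A + indicator (σ (suc p) <? σ p))
      ≡⟨ cong (λ z → inversionSum σ p′ + B + (A + z)) (indicator-< _ _ descent) ⟩
    inversionSum σ p′ + B + (A + 1)
      ≡⟨ rearrange (inversionSum σ p′) A B ⟩
    suc (inversionSum σ p′ + A + (B + 0))
      ≡⟨ cong suc (cong₂ _+_ (cong₂ _+_ (sym (inversionSum-cong σ τ p′ τ-before)) A-τ) B-τ) ⟩
    suc (inversionSum τ p′ + largerBefore τ p p′ + largerBefore τ (suc p) p) ∎
    where open ≡-Reasoning
  -- every later column counts the same entries in a different order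
  columns : ∀ N → suc p ≤ N → inversionSum σ N ≡ suc (inversionSum τ N)
  columns (suc N) p+1≤N+1 with m≤n⇒m<n∨m≡n p+1≤N+1
  ... | inj₂ refl = up-to-p+1
  ... | inj₁ p+1<N+1 = cong₂ _+_ (columns N (≤-pred p+1<N+1)) (sym same-column)
    where
    same-column : largerBefore τ (suc N) N ≡ largerBefore σ (suc N) N
    same-column = trans (cong (λ z → sumTo (λ i → indicator (z <? τ i)) N) (cong σ (transpose-after p (suc N) p+1<N+1)))
      (sumTo-transpose (λ i → indicator (σ (suc N) <? σ i)) p N (s≤s z≤n) (≤-pred p+1<N+1))

T-from-≡ : ∀ {b} → b ≡ true → T b
T-from-≡ = Equivalence.from T-≡

T-to-≡ : ∀ {b} → T b → b ≡ true
T-to-≡ = Equivalence.to T-≡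

maxBelow-cases : ∀ i R → maxBelow i R ≡ 0 ⊎ maxBelow i R ∈ R
maxBelow-cases i [] = inj₁ refl
maxBelow-cases i (q ∷ R) with q <ᵇ i
... | false = Data.Sum.map (λ eq → eq) there (maxBelow-cases i R)
... | true with ≤-total q (maxBelow i R)
...   | inj₁ q≤m rewrite m≤n⇒m⊔n≡n q≤m = Data.Sum.map (λ eq → eq) there (maxBelow-cases i R)
...   | inj₂ m≤q rewrite m≥n⇒m⊔n≡m m≤q = inj₂ (here refl)

maxBelow-< : ∀ i R → 1 ≤ i → maxBelow i R < i
maxBelow-< i [] 1≤i = 1≤i
maxBelow-< i (q ∷ R) 1≤i with q <ᵇ i in q<ᵇi
... | false = maxBelow-< i R 1≤i
... | true  = ⊔-lub (<ᵇ⇒< q i (T-from-≡ q<ᵇi)) (maxBelow-< i R 1≤i)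

maxBelow-upper : ∀ i R q → q ∈ R → q < i → q ≤ maxBelow i R
maxBelow-upper i (q ∷ R) q (here refl) q<i with q <ᵇ i in q<ᵇi
... | true  = m≤m⊔n q _
... | false = ⊥-elim (subst T q<ᵇi (<⇒<ᵇ q<i))
maxBelow-upper i (q′ ∷ R) q (there q∈) q<i with q′ <ᵇ i
... | true  = ≤-trans (maxBelow-upper i R q q∈ q<i) (m≤n⊔m q′ _)
... | false = maxBelow-upper i R q q∈ q<i

maxBelow-least : ∀ i R m → (∀ q → q ∈ R → q < i → q ≤ m) → maxBelow i R ≤ m
maxBelow-least i [] m _ = z≤n
maxBelow-least i (q ∷ R) m below with q <ᵇ i in q<ᵇi
... | false = maxBelow-least i R m (λ q′ q′∈ → below q′ (there q′∈))
... | true  = ⊔-lub (below q (here refl) (<ᵇ⇒< q i (T-from-≡ q<ᵇi))) (maxBelow-least i R m (λ q′ q′∈ → below q′ (there q′∈)))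

maxBelow-char : ∀ i R lo → (lo ≡ 0 ⊎ lo ∈ R) → lo < i → (∀ q → q ∈ R → q < i → q ≤ lo) → maxBelow i R ≡ lo
maxBelow-char i R lo lo∈ lo<i below = ≤-antisym (maxBelow-least i R lo below) (lower lo∈)
  where
  lower : (lo ≡ 0 ⊎ lo ∈ R) → lo ≤ maxBelow i R
  lower (inj₁ refl) = z≤n
  lower (inj₂ lo∈R) = maxBelow-upper i R lo lo∈R lo<i

-- minAtLeast is also used for the critical indices, hence stated for any list
minAtLeast-cases : ∀ i L d → minAtLeast i L d ≡ d ⊎ minAtLeast i L d ∈ L
minAtLeast-cases i [] d = inj₁ refl
minAtLeast-cases i (q ∷ L) d with i ≤ᵇ q
... | false = Data.Sum.map (λ eq → eq) there (minAtLeast-cases i L d)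
... | true with ≤-total q (minAtLeast i L d)
...   | inj₁ q≤m rewrite m≤n⇒m⊓n≡m q≤m = inj₂ (here refl)
...   | inj₂ m≤q rewrite m≥n⇒m⊓n≡n m≤q = Data.Sum.map (λ eq → eq) there (minAtLeast-cases i L d)

minAtLeast-≤d : ∀ i L d → minAtLeast i L d ≤ d
minAtLeast-≤d i [] d = ≤-refl
minAtLeast-≤d i (q ∷ L) d with i ≤ᵇ q
... | false = minAtLeast-≤d i L d
... | true  = ≤-trans (m⊓n≤n q _) (minAtLeast-≤d i L d)

minAtLeast-lower : ∀ i L d q → q ∈ L → i ≤ q → minAtLeast i L d ≤ q
minAtLeast-lower i (q ∷ L) d q (here refl) i≤q with i ≤ᵇ q in i≤ᵇq
... | true  = m⊓n≤m q _
... | false = ⊥-elim (subst T i≤ᵇq (≤⇒≤ᵇ i≤q))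
minAtLeast-lower i (q′ ∷ L) d q (there q∈) i≤q with i ≤ᵇ q′
... | true  = ≤-trans (m⊓n≤n q′ _) (minAtLeast-lower i L d q q∈ i≤q)
... | false = minAtLeast-lower i L d q q∈ i≤q

minAtLeast-greatest : ∀ i L d m → (∀ q → q ∈ L → i ≤ q → m ≤ q) → m ≤ d → m ≤ minAtLeast i L d
minAtLeast-greatest i [] d m _ m≤d = m≤d
minAtLeast-greatest i (q ∷ L) d m above m≤d with i ≤ᵇ q in i≤ᵇq
... | false = minAtLeast-greatest i L d m (λ q′ q′∈ → above q′ (there q′∈)) m≤d
... | true  = ⊓-glb (above q (here refl) (≤ᵇ⇒≤ i q (T-from-≡ i≤ᵇq)))
                    (minAtLeast-greatest i L d m (λ q′ q′∈ → above q′ (there q′∈)) m≤d)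

minAtLeast-≥ : ∀ i L d → i ≤ d → i ≤ minAtLeast i L d
minAtLeast-≥ i L d i≤d = minAtLeast-greatest i L d i (λ _ _ i≤q → i≤q) i≤d

minAtLeast-char : ∀ i L d e → (e ≡ d ⊎ e ∈ L) → i ≤ e → e ≤ d → (∀ q → q ∈ L → i ≤ q → e ≤ q) → minAtLeast i L d ≡ e
minAtLeast-char i L d e e∈ i≤e e≤d above = ≤-antisym (upper e∈) (minAtLeast-greatest i L d e above e≤d)
  where
  upper : (e ≡ d ⊎ e ∈ L) → minAtLeast i L d ≤ e
  upper (inj₁ refl) = minAtLeast-≤d i L d
  upper (inj₂ e∈L) = minAtLeast-lower i L d e e∈L i≤e

record Carrel (n : ℕ) (R : List ℕ) (lo e : ℕ) : Set where
  field
    lo<e     : lo < e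
    e≤n      : e ≤ n
    lo∈R     : lo ≡ 0 ⊎ lo ∈ R
    e∈R      : e ≡ n ⊎ e ∈ R
    interior : ∀ j → lo < j → j < e → j ∉ R
    start≡   : ∀ j → lo < j → j ≤ e → cStart R j ≡ lo
    end≡     : ∀ j → lo < j → j ≤ e → cEnd n R j ≡ e

carrelOf : ∀ n R i → InRange n i → Carrel n R (cStart R i) (cEnd n R i)
carrelOf n R i (1≤i , i≤n) = record
  { lo<e = <-≤-trans lo<i i≤e
  ; e≤n = minAtLeast-≤d i R n
  ; lo∈R = maxBelow-cases i R
  ; e∈R = minAtLeast-cases i R n
  ; interior = interior
  ; start≡ = λ j lo<j j≤e → maxBelow-char j R lo (maxBelow-cases i R) lo<j (λ q q∈ q<j → below q q∈ j≤e q<j)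
  ; end≡ = λ j lo<j j≤e → minAtLeast-char j R n e (minAtLeast-cases i R n) j≤e (minAtLeast-≤d i R n)
                            (λ q q∈ j≤q → above q q∈ lo<j j≤q)
  }
  where
  lo : ℕ
  lo = cStart R i
  e : ℕ
  e = cEnd n R i
  lo<i : lo < i
  lo<i = maxBelow-< i R 1≤i
  i≤e : i ≤ e
  i≤e = minAtLeast-≥ i R n i≤n
  interior : ∀ j → lo < j → j < e → j ∉ R
  interior j lo<j j<e j∈ with <-cmp j i
  ... | tri< j<i _ _ = <⇒≱ lo<j (maxBelow-upper i R j j∈ j<i)
  ... | tri≈ _ refl _ = <⇒≱ j<e (minAtLeast-lower i R n j j∈ ≤-refl)
  ... | tri> _ _ i<j = <⇒≱ j<e (minAtLeast-lower i R n j j∈ (<⇒≤ i<j))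
  outside : ∀ q → q ∈ R → q ≤ lo ⊎ e ≤ q
  outside q q∈ with q ≤? lo | e ≤? q
  ... | yes q≤lo | _ = inj₁ q≤lo
  ... | no _ | yes e≤q = inj₂ e≤q
  ... | no q≰lo | no e≰q = ⊥-elim (interior q (≰⇒> q≰lo) (≰⇒> e≰q) q∈)
  below : ∀ q → q ∈ R → ∀ {j} → j ≤ e → q < j → q ≤ lo
  below q q∈ j≤e q<j with outside q q∈
  ... | inj₁ q≤lo = q≤lo
  ... | inj₂ e≤q = ⊥-elim (<⇒≱ q<j (≤-trans j≤e e≤q))
  above : ∀ q → q ∈ R → ∀ {j} → lo < j → j ≤ q → e ≤ q
  above q q∈ lo<j j≤q with outside q q∈
  ... | inj₁ q≤lo = ⊥-elim (<⇒≱ lo<j (≤-trans j≤q q≤lo))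
  ... | inj₂ e≤q = e≤q

cEnd-self : ∀ n R e → e ≤ n → (e ≡ n ⊎ e ∈ R) → cEnd n R e ≡ e
cEnd-self n R e e≤n e∈ = minAtLeast-char e R n e e∈ ≤-refl e≤n (λ _ _ e≤q → e≤q)

transpose-perm : ∀ n σ p → 1 ≤ p → suc p ≤ n → IsPerm n σ → IsPerm n (λ i → σ (transpose p i))
transpose-perm n σ p 1≤p p+1≤n perm =
  (λ i ri → perm-range perm (transpose-range p n i 1≤p p+1≤n ri)) ,
  (λ i j ri rj τi≡τj → begin
     i                               ≡⟨ sym (transpose-involutive p i) ⟩
     transpose p (transpose p i)     ≡⟨ cong (transpose p) (perm-inj perm (transpose-range p n i 1≤p p+1≤n ri)
                                                                  (transpose-range p n j 1≤p p+1≤n rj) τi≡τj) ⟩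
     transpose p (transpose p j)     ≡⟨ transpose-involutive p j ⟩
     j                               ∎)
  where open ≡-Reasoning

transpose-avoids : ∀ n σ p → 1 ≤ p → suc p ≤ n → Avoids312 n σ → σ (suc p) < σ p
  → (∀ a → 1 ≤ a → a < p → σ a < σ p) → Avoids312 n (λ i → σ (transpose p i))
transpose-avoids n σ p 1≤p p+1≤n avoids descent ltr-max (a , b , c , 1≤a , a<b , b<c , c≤n , τb<τc , τc<τa)
  with (a ≟ p) ×-dec (b ≟ suc p) | (b ≟ p) ×-dec (c ≟ suc p)
... | yes (refl , refl) | _ =
  <-asym descent (subst₂ (λ u v → σ u < σ v) (transpose-p+1 p) (transpose-p p) (<-trans τb<τc τc<τa))
... | no _ | yes (refl , refl) =
  <-asym (ltr-max a 1≤a a<b) (subst₂ (λ u v → σ u < σ v) (transpose-p+1 p) (transpose-before p a a<b) τc<τa)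
... | no not-ab | no not-bc = avoids
  (transpose p a , transpose p b , transpose p c
  , proj₁ (transpose-range p n a 1≤p p+1≤n (1≤a , ≤-trans (<⇒≤ (<-trans a<b b<c)) c≤n))
  , transpose-mono p a b a<b not-ab , transpose-mono p b c b<c not-bc
  , proj₂ (transpose-range p n c 1≤p p+1≤n (≤-trans (s≤s z≤n) (<-trans a<b b<c) , c≤n))
  , τb<τc , τc<τa)

transpose-carrel-↭ : ∀ σ p lo e → lo < p → suc p ≤ e
  → map (λ i → σ (transpose p i)) (interval lo e) ↭ map σ (interval lo e)
transpose-carrel-↭ σ (suc p′) lo e lo<p p+1≤e =
  subst₂ _↭_ (sym τ-layout) (sym (layout σ)) (++⁺ˡ (map σ (interval lo p′)) (swap _ _ ↭-refl))
  where
  p : ℕ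
  p = suc p′
  τ : ℕ → ℕ
  τ = λ i → σ (transpose p i)
  layout : ∀ f → map f (interval lo e) ≡ map f (interval lo p′) ++ f p ∷ f (suc p) ∷ map f (interval (suc p) e)
  layout f rewrite interval-split lo p′ e (≤-pred lo<p) (≤-trans (n≤1+n p′) (≤-trans (n≤1+n p) p+1≤e))
    | interval-split p′ (suc p) e (≤-trans (n≤1+n p′) (n≤1+n p)) p+1≤e
    | interval-pair p′ = map-++ f (interval lo p′) _
  τ-layout : map τ (interval lo e) ≡ map σ (interval lo p′) ++ σ (suc p) ∷ σ p ∷ map σ (interval (suc p) e)
  τ-layout rewrite layout τ | transpose-p p | transpose-p+1 p
    | map-cong-∈ τ σ (interval lo p′) (λ x x∈ → cong σ (transpose-before p x (s≤s (proj₂ (∈interval⁻ lo p′ x∈)))))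
    | map-cong-∈ τ σ (interval (suc p) e) (λ x x∈ → cong σ (transpose-after p x (proj₁ (∈interval⁻ (suc p) e x∈))))
    = refl

projR-transpose : ∀ n R σ p → 1 ≤ p → suc p ≤ n → p ∉ R → ∀ i → InRange n i →
  projR n R (λ j → σ (transpose p j)) i ≡ projR n R σ i
projR-transpose n R σ p 1≤p p+1≤n p∉R i ri =
  cong (λ l → nth0 l (i ∸ lo ∸ 1)) (sort-resp-↭ (reorders (lo <? p) (suc p ≤? e)))
  where
  open Carrel (carrelOf n R i ri)
  lo : ℕ
  lo = cStart R i
  e : ℕ
  e = cEnd n R i
  τ : ℕ → ℕ
  τ = λ j → σ (transpose p j)
  untouched : (∀ x → x ∈ interval lo e → x ≢ p × x ≢ suc p) → map τ (interval lo e) ↭ map σ (interval lo e)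
  untouched away = ↭-reflexive (map-cong-∈ τ σ (interval lo e)
    (λ x x∈ → cong σ (transpose-other p x (proj₁ (away x x∈)) (proj₂ (away x x∈)))))
  lo≢p : lo ≢ p
  lo≢p refl with lo∈R
  ... | inj₁ lo≡0 = <⇒≢ 1≤p (sym lo≡0)
  ... | inj₂ lo∈ = p∉R lo∈
  e≢p : e ≢ p
  e≢p refl with e∈R
  ... | inj₁ e≡n = <⇒≢ p+1≤n e≡n
  ... | inj₂ e∈ = p∉R e∈
  reorders : Dec (lo < p) → Dec (suc p ≤ e) → map τ (interval lo e) ↭ map σ (interval lo e)
  reorders (yes lo<p) (yes p+1≤e) = transpose-carrel-↭ σ p lo e lo<p p+1≤e
  reorders (no lo≮p) _ = untouched (λ x x∈ →
    (λ { refl → lo≮p (proj₁ (∈interval⁻ lo e x∈)) }) ,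
    (λ { refl → lo≢p (≤-antisym (≤-pred (proj₁ (∈interval⁻ lo e x∈))) (≮⇒≥ lo≮p)) }))
  reorders (yes _) (no p+1≰e) = untouched (λ x x∈ →
    (λ { refl → e≢p (≤-antisym (≤-pred (≰⇒> p+1≰e)) (proj₂ (∈interval⁻ lo e x∈))) }) ,
    (λ { refl → p+1≰e (proj₂ (∈interval⁻ lo e x∈)) }))

MinimalLift : ℕ → List ℕ → (ℕ → ℕ) → (ℕ → ℕ) → Set
MinimalLift n R π σ = ∀ τ → IsPerm n τ → Avoids312 n τ → (∀ i → InRange n i → projR n R τ i ≡ π i)
  → inversions n σ ≤ inversions n τ

minimal-ascent : ∀ n R π σ → IsPerm n σ → Avoids312 n σ → (∀ i → InRange n i → projR n R σ i ≡ π i)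
  → MinimalLift n R π σ
  → ∀ p → 1 ≤ p → suc p ≤ n → p ∉ R → (∀ a → 1 ≤ a → a < p → σ a < σ p) → σ p < σ (suc p)
minimal-ascent n R π σ perm avoids proj minimal p 1≤p p+1≤n p∉R ltr-max with σ p <? σ (suc p)
... | yes ascent = ascent
... | no no-ascent = ⊥-elim (<⇒≱ (n<1+n _) (begin
    suc (inversionSum τ n)   ≡⟨ sym (inversionSum-transpose σ p n 1≤p p+1≤n descent) ⟩
    inversionSum σ n         ≡⟨ sym (inversions≡inversionSum n σ) ⟩
    inversions n σ           ≤⟨ minimal τ τ-perm τ-avoids τ-proj ⟩
    inversions n τ           ≡⟨ inversions≡inversionSum n τ ⟩
    inversionSum τ n         ∎))
  where
  open ≤-Reasoning
  descent : σ (suc p) < σ p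
  descent = ≤∧≢⇒< (≮⇒≥ no-ascent) (λ eq → <⇒≢ (n<1+n p)
    (sym (perm-inj perm (s≤s z≤n , p+1≤n) (1≤p , ≤-trans (n≤1+n p) p+1≤n) eq)))
  τ : ℕ → ℕ
  τ = λ i → σ (transpose p i)
  τ-perm : IsPerm n τ
  τ-perm = transpose-perm n σ p 1≤p p+1≤n perm
  τ-avoids : Avoids312 n τ
  τ-avoids = transpose-avoids n σ p 1≤p p+1≤n avoids descent ltr-max
  τ-proj : ∀ i → InRange n i → projR n R τ i ≡ π i
  τ-proj i ri = trans (projR-transpose n R σ p 1≤p p+1≤n p∉R i ri) (proj i ri)

-- The values of π on a carrel are those of σ, sorted; hence every prefix of π
-- ending at a carrel end is a rearrangement of the same prefix of σ.

applyUpTo-nth0 : ∀ (L : List ℕ) (g : ℕ → ℕ) → (∀ k → g k ≡ nth0 L k) → applyUpTo g (length L) ≡ L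
applyUpTo-nth0 [] g _ = refl
applyUpTo-nth0 (x ∷ L) g g≡ = cong₂ _∷_ (g≡ 0) (applyUpTo-nth0 L (λ k → g (suc k)) (λ k → g≡ (suc k)))

map-nth0-interval : ∀ lo (L : List ℕ) → map (λ j → nth0 L (j ∸ lo ∸ 1)) (interval lo (lo + length L)) ≡ L
map-nth0-interval lo L = begin
  map (λ j → nth0 L (j ∸ lo ∸ 1)) (interval lo (lo + length L))
    ≡⟨ cong (map (λ j → nth0 L (j ∸ lo ∸ 1))) (interval-+ lo (length L)) ⟩
  map (λ j → nth0 L (j ∸ lo ∸ 1)) (map (lo +_) (map suc (upTo (length L))))
    ≡⟨ sym (trans (map-∘ (upTo (length L))) (map-∘ (map suc (upTo (length L))))) ⟩
  map (λ k → nth0 L (lo + suc k ∸ lo ∸ 1)) (upTo (length L))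
    ≡⟨ map-upTo _ (length L) ⟩
  applyUpTo (λ k → nth0 L (lo + suc k ∸ lo ∸ 1)) (length L)
    ≡⟨ applyUpTo-nth0 L _ (λ k → cong (λ z → nth0 L (z ∸ 1)) (m+n∸m≡n lo (suc k))) ⟩
  L ∎
  where open ≡-Reasoning

carrel-values : ∀ n R σ π lo e → Carrel n R lo e → (∀ i → InRange n i → projR n R σ i ≡ π i)
  → map π (interval lo e) ≡ sort (map σ (interval lo e))
carrel-values n R σ π lo e C proj = begin
  map π (interval lo e)                                   ≡⟨ map-cong-∈ π (λ j → nth0 L (j ∸ lo ∸ 1)) (interval lo e) π≡ ⟩
  map (λ j → nth0 L (j ∸ lo ∸ 1)) (interval lo e)         ≡⟨ cong (λ z → map (λ j → nth0 L (j ∸ lo ∸ 1)) (interval lo z)) (sym lo+|L|≡e) ⟩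
  map (λ j → nth0 L (j ∸ lo ∸ 1)) (interval lo (lo + length L)) ≡⟨ map-nth0-interval lo L ⟩
  L                                                       ∎
  where
  open ≡-Reasoning
  open Carrel C
  L : List ℕ
  L = sort (map σ (interval lo e))
  lo+|L|≡e : lo + length L ≡ e
  lo+|L|≡e = trans (cong (lo +_) (trans (↭-length (sort-↭ (map σ (interval lo e))))
    (trans (length-map σ (interval lo e)) (length-interval lo e)))) (m+[n∸m]≡n (<⇒≤ lo<e))
  π≡ : ∀ j → j ∈ interval lo e → π j ≡ nth0 L (j ∸ lo ∸ 1)
  π≡ j j∈ with ∈interval⁻ lo e j∈
  ... | lo<j , j≤e = trans (sym (proj j (≤-trans (s≤s z≤n) lo<j , ≤-trans j≤e e≤n)))
    (cong₂ (λ s t → nth0 (sort (map σ (interval s t))) (j ∸ s ∸ 1)) (start≡ j lo<j j≤e) (end≡ j lo<j j≤e))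

-- positions that end a prefix made of whole carrels
Cut : ℕ → List ℕ → ℕ → Set
Cut n R e = e ≡ 0 ⊎ e ≡ n ⊎ e ∈ R

prefix-↭ : ∀ n R σ π → (∀ i → InRange n i → projR n R σ i ≡ π i)
  → ∀ e → e ≤ n → Cut n R e → map π (range e) ↭ map σ (range e)
prefix-↭ n R σ π proj = <-rec (λ e → e ≤ n → Cut n R e → map π (range e) ↭ map σ (range e)) step
  where
  step : ∀ e → (∀ {lo} → lo < e → lo ≤ n → Cut n R lo → map π (range lo) ↭ map σ (range lo))
    → e ≤ n → Cut n R e → map π (range e) ↭ map σ (range e)
  step zero _ _ _ = ↭-refl
  step (suc e′) earlier e≤n (inj₁ ())
  step (suc e′) earlier e′<n (inj₂ e∈) = subst₂ _↭_ (sym π-split) (sym σ-split)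
    (↭-trans (++⁺ʳ (sort (map σ (interval lo e))) (earlier lo<e (≤-trans (<⇒≤ lo<e) e′<n) lo-cut))
             (++⁺ˡ (map σ (range lo)) (sort-↭ (map σ (interval lo e)))))
    where
    e : ℕ
    e = suc e′
    lo : ℕ
    lo = cStart R e
    C : Carrel n R lo e
    C = subst (Carrel n R lo) (cEnd-self n R e e′<n e∈) (carrelOf n R e (s≤s z≤n , e′<n))
    open Carrel C using (lo<e; lo∈R)
    lo-cut : Cut n R lo
    lo-cut = Data.Sum.map (λ eq → eq) inj₂ lo∈R
    σ-split : map σ (range e) ≡ map σ (range lo) ++ map σ (interval lo e)
    σ-split = trans (cong (map σ) (range-split lo e (<⇒≤ lo<e))) (map-++ σ (range lo) (interval lo e))
    π-split : map π (range e) ≡ map π (range lo) ++ sort (map σ (interval lo e))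
    π-split = trans (cong (map π) (range-split lo e (<⇒≤ lo<e)))
      (trans (map-++ π (range lo) (interval lo e)) (cong (map π (range lo) ++_) (carrel-values n R σ π lo e C proj)))

∸-split : ∀ a c d → a ≤ c → c ≤ d → d ∸ a ≡ (d ∸ c) + (c ∸ a)
∸-split a c d a≤c c≤d = sym (trans (sym (+-∸-assoc (d ∸ c) a≤c)) (cong (_∸ a) (m∸n+n≡m c≤d)))

∸-suc : ∀ x y → y < x → x ∸ y ≡ suc (x ∸ suc y)
∸-suc (suc x) zero _ = refl
∸-suc (suc x) (suc y) y<x = ∸-suc x y (≤-pred y<x)

Drop : (ℕ → ℕ) → ℕ → ℕ → Set
Drop υ x y = υ y + (x ∸ y) < υ x

suc-∸1 : ∀ x → 0 < x → suc (x ∸ 1) ≡ x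
suc-∸1 (suc x) _ = refl

findBelow-just : ∀ υ lo x k y → findBelow υ lo x k ≡ just y → lo < y × y ≤ k × Drop υ x y
findBelow-just υ lo x (suc k) y found with lo <ᵇ suc k in lo<ᵇk | υ (suc k) + (x ∸ suc k) <ᵇ υ x in drop
findBelow-just υ lo x (suc k) y () | false | _
findBelow-just υ lo x (suc k) y refl | true | true = <ᵇ⇒< lo (suc k) (T-from-≡ lo<ᵇk) , ≤-refl , <ᵇ⇒< _ _ (T-from-≡ drop)
findBelow-just υ lo x (suc k) y found | true | false with findBelow-just υ lo x k y found
... | lo<y , y≤k , y-drop = lo<y , m≤n⇒m≤1+n y≤k , y-drop

findBelow-largest : ∀ υ lo x k y → findBelow υ lo x k ≡ just y → ∀ y′ → y < y′ → y′ ≤ k → ¬ Drop υ x y′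
findBelow-largest υ lo x (suc k) y found y′ y<y′ y′≤k y′-drop
  with lo <ᵇ suc k | υ (suc k) + (x ∸ suc k) <ᵇ υ x in drop
findBelow-largest υ lo x (suc k) y () y′ y<y′ y′≤k y′-drop | false | _
findBelow-largest υ lo x (suc k) y refl y′ y<y′ y′≤k y′-drop | true | true = <⇒≱ y<y′ y′≤k
findBelow-largest υ lo x (suc k) y found y′ y<y′ y′≤k y′-drop | true | false with m≤n⇒m<n∨m≡n y′≤k
... | inj₁ y′<k+1 = findBelow-largest υ lo x k y found y′ y<y′ (≤-pred y′<k+1) y′-drop
... | inj₂ refl = subst T drop (<⇒<ᵇ y′-drop)

findBelow-nothing : ∀ υ lo x k → findBelow υ lo x k ≡ nothing → ∀ y′ → lo < y′ → y′ ≤ k → ¬ Drop υ x y′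
findBelow-nothing υ lo x zero _ y′ lo<y′ y′≤0 _ = <⇒≱ (≤-<-trans z≤n lo<y′) y′≤0
findBelow-nothing υ lo x (suc k) none y′ lo<y′ y′≤k y′-drop
  with lo <ᵇ suc k in lo<ᵇk | υ (suc k) + (x ∸ suc k) <ᵇ υ x in drop
... | false | _ = subst T lo<ᵇk (<⇒<ᵇ (<-≤-trans lo<y′ y′≤k))
findBelow-nothing υ lo x (suc k) () y′ lo<y′ y′≤k y′-drop | true | true
... | true | false with m≤n⇒m<n∨m≡n y′≤k
...   | inj₁ y′<k+1 = findBelow-nothing υ lo x k none y′ lo<y′ (≤-pred y′<k+1) y′-drop
...   | inj₂ refl = subst T drop (<⇒<ᵇ y′-drop)

chain-head : ∀ υ lo x fuel → 1 ≤ fuel → x ∈ critChain υ lo x fuel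
chain-head υ lo x (suc fuel) _ = here refl

chain-above : ∀ υ lo b x fuel → (∀ y → lo < y → y ≤ b → υ b ≤ υ y + (b ∸ y)) → b ≤ x
  → All (b ≤_) (critChain υ lo x fuel)
chain-above υ lo b x zero _ _ = []
chain-above υ lo b x (suc fuel) flat b≤x with findBelow υ lo x (x ∸ 1) in found
... | nothing = b≤x ∷ []
... | just y = b≤x ∷ chain-above υ lo b y fuel flat b≤y
  where
  y-facts : lo < y × y ≤ x ∸ 1 × Drop υ x y
  y-facts = findBelow-just υ lo x (x ∸ 1) y found
  lo<y : lo < y
  lo<y = proj₁ y-facts
  y-drop : Drop υ x y
  y-drop = proj₂ (proj₂ y-facts)
  b≤y : b ≤ y
  b≤y with b ≤? y
  ... | yes b≤y = b≤y
  ... | no b≰y = ⊥-elim (findBelow-largest υ lo x (x ∸ 1) y found b y<b b≤x-1 b-drop)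
    where
    y<b : y < b
    y<b = ≰⇒> b≰y
    -- a drop at y below b would also be a drop at b
    b-drop : Drop υ x b
    b-drop = ≤-<-trans (begin
      υ b + (x ∸ b)                  ≤⟨ +-monoˡ-≤ (x ∸ b) (flat y lo<y (<⇒≤ y<b)) ⟩
      υ y + (b ∸ y) + (x ∸ b)        ≡⟨ +-assoc (υ y) _ _ ⟩
      υ y + ((b ∸ y) + (x ∸ b))      ≡⟨ cong (υ y +_) (+-comm (b ∸ y) (x ∸ b)) ⟩
      υ y + ((x ∸ b) + (b ∸ y))      ≡⟨ cong (υ y +_) (sym (∸-split y b x (<⇒≤ y<b) b≤x)) ⟩
      υ y + (x ∸ y)                  ∎) y-drop
      where open ≤-Reasoning
    b≤x-1 : b ≤ x ∸ 1
    b≤x-1 with m≤n⇒m<n∨m≡n b≤x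
    ... | inj₁ b<x = ≤-pred (subst (b <_) (sym (suc-∸1 x (≤-<-trans z≤n b<x))) b<x)
    ... | inj₂ refl = ⊥-elim (<-irrefl refl (≤-<-trans (flat y lo<y (<⇒≤ y<b)) y-drop))

chain-catches : ∀ υ lo fuel x → 1 ≤ x → x ≤ fuel → ∀ c → c ∈ critChain υ lo x fuel
  → ∀ y → lo < y → y < c → Drop υ c y → ∃[ c′ ] (c′ ∈ critChain υ lo x fuel × y ≤ c′ × c′ < c)
chain-catches υ lo (suc fuel) x 1≤x x≤fuel c c∈ y lo<y y<c y-drop with findBelow υ lo x (x ∸ 1) in found
chain-catches υ lo (suc fuel) x 1≤x x≤fuel c (here refl) y lo<y y<c y-drop | nothing =
  ⊥-elim (findBelow-nothing υ lo x (x ∸ 1) found y lo<y (≤-pred (subst (y <_) (sym (suc-∸1 x 1≤x)) y<c)) y-drop)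
chain-catches υ lo (suc fuel) x 1≤x x≤fuel c (here refl) y lo<y y<c y-drop | just x′ =
  x′ , there (chain-head υ lo x′ fuel 1≤fuel) , y≤x′ , x′<x
  where
  x′-facts : lo < x′ × x′ ≤ x ∸ 1 × Drop υ x x′
  x′-facts = findBelow-just υ lo x (x ∸ 1) x′ found
  x′<x : x′ < x
  x′<x = <-≤-trans (s≤s (proj₁ (proj₂ x′-facts))) (≤-reflexive (suc-∸1 x 1≤x))
  1≤fuel : 1 ≤ fuel
  1≤fuel = ≤-trans (≤-<-trans z≤n (proj₁ x′-facts)) (≤-pred (<-≤-trans x′<x x≤fuel))
  y≤x′ : y ≤ x′
  y≤x′ with y ≤? x′
  ... | yes y≤x′ = y≤x′
  ... | no y≰x′ = ⊥-elim (findBelow-largest υ lo x (x ∸ 1) x′ found y (≰⇒> y≰x′)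
                           (≤-pred (subst (y <_) (sym (suc-∸1 x 1≤x)) y<c)) y-drop)
chain-catches υ lo (suc fuel) x 1≤x x≤fuel c (there c∈) y lo<y y<c y-drop | just x′
  with chain-catches υ lo fuel x′ 1≤x′ x′≤fuel c c∈ y lo<y y<c y-drop
  where
  x′-facts : lo < x′ × x′ ≤ x ∸ 1 × Drop υ x x′
  x′-facts = findBelow-just υ lo x (x ∸ 1) x′ found
  1≤x′ : 1 ≤ x′
  1≤x′ = ≤-<-trans z≤n (proj₁ x′-facts)
  x′≤fuel : x′ ≤ fuel
  x′≤fuel = ≤-pred (<-≤-trans (<-≤-trans (s≤s (proj₁ (proj₂ x′-facts))) (≤-reflexive (suc-∸1 x 1≤x))) x≤fuel)
... | c′ , c′∈ , y≤c′ , c′<c = c′ , there c′∈ , y≤c′ , c′<c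

record CarrelShape (υ : ℕ → ℕ) (lo b e : ℕ) : Set where
  field
    b≤e        : b ≤ e
    lo<e       : lo < e
    flat       : ∀ y → lo < y → y ≤ b → υ b ≤ υ y + (b ∸ y)
    increasing : ∀ j → lo < j → b ≤ j → j < e → υ j < υ (suc j)

-- Δ_R(υ)_i for i in the carrel (lo, e]; ΔR n R υ i unfolds to this
coreValue : (ℕ → ℕ) → ℕ → ℕ → ℕ → ℕ
coreValue υ lo e i = υ x ∸ (x ∸ i)
  where
  x : ℕ
  x = minAtLeast i (critChain υ lo e e) e

module CoreOfShape (υ : ℕ → ℕ) (lo b e : ℕ) (shape : CarrelShape υ lo b e) where
  open CarrelShape shape

  chain : List ℕ
  chain = critChain υ lo e e

  chain-above-b : All (b ≤_) chain
  chain-above-b = chain-above υ lo b e e flat b≤e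

  grows : ∀ j k → lo < j → b ≤ j → j ≤ k → k ≤ e → υ j + (k ∸ j) ≤ υ k
  grows j zero lo<j _ j≤0 _ = ⊥-elim (<⇒≱ (≤-<-trans z≤n lo<j) j≤0)
  grows j (suc k) lo<j b≤j j≤k+1 k+1≤e with m≤n⇒m<n∨m≡n j≤k+1
  ... | inj₂ refl = ≤-reflexive (trans (cong (υ j +_) (n∸n≡0 j)) (+-identityʳ (υ j)))
  ... | inj₁ j<k+1 = begin
      υ j + (suc k ∸ j)      ≡⟨ cong (υ j +_) (+-∸-assoc 1 (≤-pred j<k+1)) ⟩
      υ j + suc (k ∸ j)      ≡⟨ +-suc (υ j) _ ⟩
      suc (υ j + (k ∸ j))    ≤⟨ s≤s (grows j k lo<j b≤j (≤-pred j<k+1) (≤-trans (n≤1+n k) k+1≤e)) ⟩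
      suc (υ k)              ≤⟨ increasing k (<-≤-trans lo<j (≤-pred j<k+1)) (≤-trans b≤j (≤-pred j<k+1)) k+1≤e ⟩
      υ (suc k)              ∎
    where open ≤-Reasoning

  module AtPosition (i : ℕ) (lo<i : lo < i) (i≤e : i ≤ e) where
    x : ℕ
    x = minAtLeast i chain e

    i≤x : i ≤ x
    i≤x = minAtLeast-≥ i chain e i≤e

    x∈chain : x ∈ chain
    x∈chain with minAtLeast-cases i chain e
    ... | inj₁ x≡e = subst (_∈ chain) (sym x≡e) (chain-head υ lo e e (≤-<-trans z≤n lo<e))
    ... | inj₂ x∈ = x∈

    b≤x : b ≤ x
    b≤x = All.lookup chain-above-b x∈chain

    -- no drop onto x from [i, x): it would be caught by a critical index in [i, x)
    no-drop : ∀ y → i ≤ y → y < x → ¬ Drop υ x y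
    no-drop y i≤y y<x y-drop with chain-catches υ lo e e (≤-<-trans z≤n lo<e) ≤-refl x x∈chain y (<-≤-trans lo<i i≤y) y<x y-drop
    ... | c′ , c′∈ , y≤c′ , c′<x = <⇒≱ c′<x (minAtLeast-lower i chain e c′ c′∈ (≤-trans i≤y y≤c′))

    x-from : ∀ j → i ≤ j → j ≤ x → b ≤ j → υ x ≡ υ j + (x ∸ j)
    x-from j i≤j j≤x b≤j with m≤n⇒m<n∨m≡n j≤x
    ... | inj₂ refl = sym (trans (cong (υ j +_) (n∸n≡0 j)) (+-identityʳ (υ j)))
    ... | inj₁ j<x = ≤-antisym (≮⇒≥ (no-drop j i≤j j<x))
                               (grows j x (<-≤-trans lo<i i≤j) b≤j j≤x (minAtLeast-≤d i chain e))

  core-above : ∀ i → lo < i → i ≤ e → b ≤ i → coreValue υ lo e i ≡ υ i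
  core-above i lo<i i≤e b≤i = trans (cong (_∸ (x ∸ i)) (x-from i ≤-refl i≤x b≤i)) (m+n∸n≡m (υ i) (x ∸ i))
    where open AtPosition i lo<i i≤e

  core-below : ∀ i → lo < i → i ≤ e → i ≤ b → coreValue υ lo e i ≡ υ b ∸ (b ∸ i)
  core-below i lo<i i≤e i≤b = begin
    υ x ∸ (x ∸ i)                               ≡⟨ cong₂ _∸_ (x-from b i≤b b≤x ≤-refl) (∸-split i b x i≤b b≤x) ⟩
    (υ b + (x ∸ b)) ∸ ((x ∸ b) + (b ∸ i))       ≡⟨ sym (∸-+-assoc (υ b + (x ∸ b)) (x ∸ b) (b ∸ i)) ⟩
    (υ b + (x ∸ b)) ∸ (x ∸ b) ∸ (b ∸ i)         ≡⟨ cong (_∸ (b ∸ i)) (m+n∸n≡m (υ b) (x ∸ b)) ⟩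
    υ b ∸ (b ∸ i)                               ∎
    where
    open ≡-Reasoning
    open AtPosition i lo<i i≤e

values↓ : (ℕ → ℕ) → ℕ → List ℕ
values↓ σ t = descending (map σ (range t))

∈values↓⁻ : ∀ σ t x → x ∈ values↓ σ t → ∃[ c ] (1 ≤ c × c ≤ t × σ c ≡ x)
∈values↓⁻ σ t x x∈ with ∈-map⁻ σ (∈-resp-↭ (descending-↭ (map σ (range t))) x∈)
... | c , c∈ , refl = c , proj₁ (∈range⁻ t c∈) , proj₂ (∈range⁻ t c∈) , refl

∈values↓⁺ : ∀ σ t c → 1 ≤ c → c ≤ t → σ c ∈ values↓ σ t
∈values↓⁺ σ t c 1≤c c≤t = ∈-resp-↭ (↭-sym (descending-↭ (map σ (range t)))) (∈-map⁺ σ (∈range⁺ t 1≤c c≤t))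

values↓-strict : ∀ n σ → IsPerm n σ → ∀ t → t ≤ n → AllPairs _>_ (values↓ σ t)
values↓-strict n σ perm t t≤n = descending-strict (map σ (range t)) (distinct-prefix n σ perm t t≤n)

values↓-head : ∀ n σ → IsPerm n σ → ∀ t → t ≤ n → nth0 (values↓ σ t) 0 ≡ Ψ σ t
values↓-head n σ perm zero _ = refl
values↓-head n σ perm (suc t) t≤n with Ψ-attained σ (suc t) (s≤s z≤n)
... | a , 1≤a , a≤t , Ψ≡σa = nth0-head _ _ (values↓-strict n σ perm (suc t) t≤n)
  (subst (_∈ values↓ σ (suc t)) (sym Ψ≡σa) (∈values↓⁺ σ (suc t) a 1≤a a≤t)) bounded
  where
  bounded : ∀ w → w ∈ values↓ σ (suc t) → w ≤ Ψ σ (suc t)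
  bounded w w∈ with ∈values↓⁻ σ (suc t) w w∈
  ... | c , 1≤c , c≤t , refl = Ψ-upper σ (suc t) c 1≤c c≤t

elemᵇ⁻ : ∀ x xs → elemᵇ x xs ≡ true → x ∈ xs
elemᵇ⁻ x xs found = Any.map (λ y≡ᵇx → sym (≡ᵇ⇒≡ _ x y≡ᵇx)) (any⁻ (λ y → y ≡ᵇ x) xs (T-from-≡ found))

elemᵇ⁺ : ∀ x xs → x ∈ xs → elemᵇ x xs ≡ true
elemᵇ⁺ x xs x∈ = T-to-≡ (any⁺ (λ y → y ≡ᵇ x) (Any.map (λ { refl → ≡⇒≡ᵇ x x refl }) x∈))

∧-true : ∀ a c → a ∧ c ≡ true → a ≡ true × c ≡ true
∧-true true true _ = refl , refl

if-cases : ∀ (c : Bool) {A B t : ℕ} → (c ≡ true → A ≡ t) → B ≡ t → (if c then A else B) ≡ t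
if-cases true  A≡t _ = A≡t refl
if-cases false _ B≡t = B≡t

if-true : ∀ (c : Bool) {A B : ℕ} → c ≡ true → (if c then A else B) ≡ A
if-true true refl = refl

foldr-⊓-lower : ∀ m d (L : List ℕ) → m ≤ d → All (m ≤_) L → m ≤ foldr _⊓_ d L
foldr-⊓-lower m d [] m≤d [] = m≤d
foldr-⊓-lower m d (c ∷ L) m≤d (m≤c ∷ m≤L) = ⊓-glb m≤c (foldr-⊓-lower m d L m≤d m≤L)

-- Φ_R(γ)_i for i in the carrel (lo, e]; ΦR n R γ i unfolds to this
raisedValue : List ℕ → (ℕ → ℕ) → ℕ → ℕ → ℕ → ℕ
raisedValue R γ lo e i =
  if elemᵇ lo R ∧ (lo <ᵇ i) ∧ (i <ᵇ foldr _⊓_ e (critChain γ lo e e)) then γ lo ⊔ γ i else γ i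

-- The shape of a minimal lift σ on one carrel (lo, e].  The left-to-right
-- maxima of σ in the carrel form a final segment (b, e]; below it the prefix
-- maximum stays at M = Ψ(σ)_lo and σ decreases through values just below M.

module MinimalOnCarrel
  (n : ℕ) (R : List ℕ) (π σ : ℕ → ℕ) (perm : IsPerm n σ) (avoids : Avoids312 n σ)
  (proj : ∀ i → InRange n i → projR n R σ i ≡ π i) (minimal : MinimalLift n R π σ)
  (lo e : ℕ) (C : Carrel n R lo e) where

  open Carrel C

  in-carrel : ∀ {j} → 1 ≤ j → j ≤ e → InRange n j
  in-carrel 1≤j j≤e = 1≤j , ≤-trans j≤e e≤n

  LTRMax : ℕ → Set
  LTRMax j = Ψ σ (j ∸ 1) < σ j

  Ψ-at-max : ∀ j → 1 ≤ j → LTRMax j → Ψ σ j ≡ σ j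
  Ψ-at-max (suc j) _ max = trans (Ψ-suc σ j) (m≤n⇒m⊔n≡n (<⇒≤ max))

  Ψ-at-nonmax : ∀ j → 1 ≤ j → ¬ LTRMax j → Ψ σ j ≡ Ψ σ (j ∸ 1)
  Ψ-at-nonmax (suc j) _ not-max = trans (Ψ-suc σ j) (m≥n⇒m⊔n≡m (≮⇒≥ not-max))

  -- by minimality, a left-to-right maximum inside the carrel is followed by another one
  max-step : ∀ j → lo < j → suc j ≤ e → LTRMax j → LTRMax (suc j)
  max-step (suc j) lo<j j<e max = subst (_< σ (suc (suc j))) (sym (Ψ-at-max (suc j) (s≤s z≤n) max))
    (minimal-ascent n R π σ perm avoids proj minimal (suc j) (s≤s z≤n) (≤-trans j<e e≤n) (interior (suc j) lo<j j<e)
      (λ a 1≤a a≤j → ≤-<-trans (Ψ-upper σ j a 1≤a (≤-pred a≤j)) max))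

  max-steps : ∀ j k → lo < j → j ≤ k → k ≤ e → LTRMax j → LTRMax k
  max-steps j zero lo<j j≤0 _ _ = ⊥-elim (<⇒≱ (≤-<-trans z≤n lo<j) j≤0)
  max-steps j (suc k) lo<j j≤k+1 k+1≤e max with m≤n⇒m<n∨m≡n j≤k+1
  ... | inj₂ refl = max
  ... | inj₁ j<k+1 = max-step k (<-≤-trans lo<j (≤-pred j<k+1)) k+1≤e
                       (max-steps j k lo<j (≤-pred j<k+1) (≤-trans (n≤1+n k) k+1≤e) max)

  Threshold : ℕ → Set
  Threshold t = ∃[ b ] (lo ≤ b × b ≤ t × (∀ j → lo < j → j ≤ b → ¬ LTRMax j) × (∀ j → b < j → j ≤ t → LTRMax j))

  threshold : ∀ t → lo ≤ t → t ≤ e → Threshold t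
  threshold t lo≤t t≤e with m≤n⇒m<n∨m≡n lo≤t
  ... | inj₂ refl = lo , ≤-refl , ≤-refl , (λ j lo<j j≤lo → ⊥-elim (<⇒≱ lo<j j≤lo)) , (λ j lo<j j≤lo → ⊥-elim (<⇒≱ lo<j j≤lo))
  threshold (suc t) _ t+1≤e | inj₁ lo<t+1 with threshold t (≤-pred lo<t+1) (≤-trans (n≤1+n t) t+1≤e) | Ψ σ t <? σ (suc t)
  ... | b , lo≤b , b≤t , below , above | yes max = b , lo≤b , m≤n⇒m≤1+n b≤t , below , extended
    where
    extended : ∀ j → b < j → j ≤ suc t → LTRMax j
    extended j b<j j≤t+1 with m≤n⇒m<n∨m≡n j≤t+1
    ... | inj₁ j<t+1 = above j b<j (≤-pred j<t+1)
    ... | inj₂ refl = max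
  ... | _ | no not-max = suc t , ≤-pred (m≤n⇒m≤1+n lo<t+1) , ≤-refl ,
        (λ j lo<j j≤t+1 max → not-max (max-steps j (suc t) lo<j j≤t+1 t+1≤e max)) ,
        (λ j t+1<j j≤t+1 → ⊥-elim (<⇒≱ t+1<j j≤t+1))

  b : ℕ
  b = proj₁ (threshold e (<⇒≤ lo<e) ≤-refl)

  lo≤b : lo ≤ b
  lo≤b = proj₁ (proj₂ (threshold e (<⇒≤ lo<e) ≤-refl))

  b≤e : b ≤ e
  b≤e = proj₁ (proj₂ (proj₂ (threshold e (<⇒≤ lo<e) ≤-refl)))

  not-max-below : ∀ j → lo < j → j ≤ b → ¬ LTRMax j
  not-max-below = proj₁ (proj₂ (proj₂ (proj₂ (threshold e (<⇒≤ lo<e) ≤-refl))))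

  max-above : ∀ j → b < j → j ≤ e → LTRMax j
  max-above = proj₂ (proj₂ (proj₂ (proj₂ (threshold e (<⇒≤ lo<e) ≤-refl))))

  M : ℕ
  M = Ψ σ lo

  Ψ-flat : ∀ j → lo ≤ j → j ≤ b → Ψ σ j ≡ M
  Ψ-flat j lo≤j j≤b with m≤n⇒m<n∨m≡n lo≤j
  ... | inj₂ refl = refl
  Ψ-flat (suc j) _ j+1≤b | inj₁ lo<j+1 =
    trans (Ψ-at-nonmax (suc j) (s≤s z≤n) (not-max-below (suc j) lo<j+1 j+1≤b))
          (Ψ-flat j (≤-pred lo<j+1) (≤-trans (n≤1+n j) j+1≤b))

  Ψ-record : ∀ j → b < j → j ≤ e → Ψ σ j ≡ σ j
  Ψ-record j b<j j≤e = Ψ-at-max j (≤-<-trans z≤n b<j) (max-above j b<j j≤e)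

  Ψ-increasing : ∀ j → b ≤ j → j < e → Ψ σ j < Ψ σ (suc j)
  Ψ-increasing j b≤j j<e = subst (Ψ σ j <_) (sym (Ψ-record (suc j) (s≤s b≤j) j<e)) (max-above (suc j) (s≤s b≤j) j<e)

  Ψ-shape : CarrelShape (Ψ σ) lo b e
  Ψ-shape = record
    { b≤e = b≤e ; lo<e = lo<e
    ; flat = λ y lo<y y≤b → subst₂ (λ u v → u ≤ v + (b ∸ y)) (sym (Ψ-flat b lo≤b ≤-refl)) (sym (Ψ-flat y (<⇒≤ lo<y) y≤b))
                                   (m≤m+n M (b ∸ y))
    ; increasing = λ j _ b≤j j<e → Ψ-increasing j b≤j j<e }

  module BelowThreshold (lo<b : lo < b) where

    1≤lo : 1 ≤ lo
    1≤lo with 1 ≤? lo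
    ... | yes 1≤lo = 1≤lo
    ... | no 1≰lo = ⊥-elim (not-max-below 1 (≰⇒> 1≰lo) (≤-trans (s≤s z≤n) lo<b)
                              (proj₁ (perm-range perm (in-carrel ≤-refl (≤-<-trans z≤n lo<e)))))

    a : ℕ
    a = proj₁ (Ψ-attained σ lo 1≤lo)

    1≤a : 1 ≤ a
    1≤a = proj₁ (proj₂ (Ψ-attained σ lo 1≤lo))

    a≤lo : a ≤ lo
    a≤lo = proj₁ (proj₂ (proj₂ (Ψ-attained σ lo 1≤lo)))

    M≡σa : M ≡ σ a
    M≡σa = proj₂ (proj₂ (proj₂ (Ψ-attained σ lo 1≤lo)))

    a∈[n] : InRange n a
    a∈[n] = in-carrel 1≤a (≤-trans a≤lo (<⇒≤ lo<e))

    b∈[n] : InRange n b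
    b∈[n] = in-carrel (≤-trans (s≤s z≤n) lo<b) b≤e

    below-M : ∀ j → lo < j → j ≤ b → σ j < M
    below-M (suc j) lo<j j≤b = ≤∧≢⇒< σj≤M σj≢M
      where
      σj≤M : σ (suc j) ≤ M
      σj≤M = subst (σ (suc j) ≤_) (Ψ-flat j (≤-pred lo<j) (≤-trans (n≤1+n j) j≤b)) (≮⇒≥ (not-max-below (suc j) lo<j j≤b))
      σj≢M : σ (suc j) ≢ M
      σj≢M eq = <⇒≢ (≤-<-trans a≤lo lo<j)
        (perm-inj perm a∈[n] (in-carrel (s≤s z≤n) (≤-trans j≤b b≤e)) (trans (sym M≡σa) (sym eq)))

    -- an ascent σ_j < σ_{j+1} < M = σ_a would be a 312 pattern
    decreasing : ∀ j → lo < j → suc j ≤ b → σ (suc j) < σ j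
    decreasing j lo<j j+1≤b with σ j <? σ (suc j)
    ... | yes ascent = ⊥-elim (avoids (a , j , suc j , 1≤a , ≤-<-trans a≤lo lo<j , ≤-refl , ≤-trans j+1≤b (≤-trans b≤e e≤n) ,
          ascent , subst (σ (suc j) <_) M≡σa (below-M (suc j) (<-trans lo<j (n<1+n j)) j+1≤b)))
    ... | no no-ascent = ≤∧≢⇒< (≮⇒≥ no-ascent) (λ eq → <⇒≢ (n<1+n j)
          (sym (perm-inj perm (in-carrel (s≤s z≤n) (≤-trans j+1≤b b≤e)) (in-carrel (≤-trans (s≤s z≤n) lo<j) (≤-trans (n≤1+n j) (≤-trans j+1≤b b≤e))) eq)))

    room-below-M : ∀ j → lo < j → j ≤ b → σ j + (j ∸ lo) ≤ M
    room-below-M (suc j) lo<j+1 j+1≤b with m≤n⇒m<n∨m≡n (≤-pred lo<j+1)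
    ... | inj₂ refl = subst (_≤ M) (sym (trans (cong (σ (suc j) +_) (+-∸-assoc 1 {j} ≤-refl))
          (trans (cong (λ z → σ (suc j) + suc z) (n∸n≡0 j)) (+-comm (σ (suc j)) 1)))) (below-M (suc j) lo<j+1 j+1≤b)
    ... | inj₁ lo<j = begin
        σ (suc j) + (suc j ∸ lo)    ≡⟨ cong (σ (suc j) +_) (+-∸-assoc 1 (<⇒≤ lo<j)) ⟩
        σ (suc j) + suc (j ∸ lo)    ≡⟨ +-suc (σ (suc j)) _ ⟩
        suc (σ (suc j) + (j ∸ lo))  ≤⟨ +-monoˡ-≤ (j ∸ lo) (decreasing j lo<j j+1≤b) ⟩
        σ j + (j ∸ lo)              ≤⟨ room-below-M j lo<j (≤-trans (n≤1+n j) j+1≤b) ⟩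
        M                           ∎
      where open ≤-Reasoning

    -- every value between σ_b and M occurs at or before e: a later occurrence c
    -- would give the 312 pattern a < b < c
    occurs-by-e : ∀ v → σ b ≤ v → v ≤ M → ∃[ c ] (1 ≤ c × c ≤ e × σ c ≡ v)
    occurs-by-e v σb≤v v≤M
      with perm-surjective n σ perm v (≤-trans (proj₁ (perm-range perm b∈[n])) σb≤v ,
                                       ≤-trans v≤M (subst (_≤ n) (sym M≡σa) (proj₂ (perm-range perm a∈[n]))))
    ... | c , (1≤c , c≤n) , σc≡v with c ≤? e
    ...   | yes c≤e = c , 1≤c , c≤e , σc≡v
    ...   | no c≰e with σ b ≟ v | v ≟ M
    ...     | yes σb≡v | _ = ⊥-elim (c≰e (subst (_≤ e) (perm-inj perm b∈[n] (1≤c , c≤n) (trans σb≡v (sym σc≡v))) b≤e))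
    ...     | no _ | yes v≡M = ⊥-elim (c≰e (≤-trans (subst (_≤ lo) (perm-inj perm a∈[n] (1≤c , c≤n)
                                   (trans (sym M≡σa) (trans (sym v≡M) (sym σc≡v)))) a≤lo) (<⇒≤ lo<e)))
    ...     | no σb≢v | no v≢M = ⊥-elim (avoids (a , b , c , 1≤a , ≤-<-trans a≤lo lo<b , <-≤-trans (s≤s b≤e) (≰⇒> c≰e) , c≤n ,
              subst (σ b <_) (sym σc≡v) (≤∧≢⇒< σb≤v σb≢v) , subst₂ _<_ (sym σc≡v) M≡σa (≤∧≢⇒< v≤M v≢M)))

  D : List ℕ
  D = values↓ σ e

  D-strict : AllPairs _>_ D
  D-strict = values↓-strict n σ perm e e≤n

  rank-above : ∀ k j → e ∸ j ≡ k → b ≤ j → lo < j → j ≤ e → nth0 D k ≡ Ψ σ j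
  rank-above zero j e∸j≡0 b≤j lo<j j≤e =
    subst (λ z → nth0 D 0 ≡ Ψ σ z) (≤-antisym (m∸n≡0⇒m≤n e∸j≡0) j≤e) (values↓-head n σ perm e e≤n)
  rank-above (suc k) j e∸j≡k+1 b≤j lo<j j≤e = nth0-next D k (Ψ σ (suc j)) (Ψ σ j) D-strict previous Ψj∈D
    (Ψ-increasing j b≤j j<e) nothing-between
    where
    j<e : j < e
    j<e = m∸n≢0⇒n<m (λ e∸j≡0 → 0≢1+n (trans (sym e∸j≡0) e∸j≡k+1))
    previous : nth0 D k ≡ Ψ σ (suc j)
    previous = rank-above k (suc j) (suc-injective (trans (sym (∸-suc e j j<e)) e∸j≡k+1))
      (≤-trans b≤j (n≤1+n j)) (<-trans lo<j (n<1+n j)) j<e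
    Ψj∈D : Ψ σ j ∈ D
    Ψj∈D with Ψ-attained σ j (≤-<-trans z≤n lo<j)
    ... | a , 1≤a , a≤j , Ψ≡σa = subst (_∈ D) (sym Ψ≡σa) (∈values↓⁺ σ e a 1≤a (≤-trans a≤j j≤e))
    -- a value σ_c above Ψ(σ)_j has c > j, so it is at least the record Ψ(σ)_{j+1}
    nothing-between : ∀ u → u ∈ D → u < Ψ σ (suc j) → u ≤ Ψ σ j
    nothing-between u u∈ u<Ψ with ∈values↓⁻ σ e u u∈
    ... | c , 1≤c , c≤e , refl with c ≤? j
    ...   | yes c≤j = Ψ-upper σ j c 1≤c c≤j
    ...   | no c≰j = ⊥-elim (<⇒≱ u<Ψ (subst (Ψ σ (suc j) ≤_) (Ψ-record c (<-≤-trans (s≤s b≤j) (≰⇒> c≰j)) c≤e)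
                                                           (Ψ-mono σ (suc j) c (≰⇒> c≰j))))

  module RanksBelowThreshold (lo<b : lo < b) where
    open BelowThreshold lo<b

    rank-below : ∀ k j → b ∸ j ≡ k → lo < j → j ≤ b → nth0 D (e ∸ j) ≡ M ∸ (b ∸ j)
    rank-below zero j b∸j≡0 lo<j j≤b = begin
      nth0 D (e ∸ j)   ≡⟨ cong (λ z → nth0 D (e ∸ z)) j≡b ⟩
      nth0 D (e ∸ b)   ≡⟨ rank-above (e ∸ b) b refl ≤-refl lo<b b≤e ⟩
      Ψ σ b            ≡⟨ Ψ-flat b lo≤b ≤-refl ⟩
      M                ≡⟨ cong (M ∸_) (sym b∸j≡0) ⟩
      M ∸ (b ∸ j)      ∎
      where
      open ≡-Reasoning
      j≡b : j ≡ b
      j≡b = ≤-antisym j≤b (m∸n≡0⇒m≤n b∸j≡0)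
    rank-below (suc k) j b∸j≡k+1 lo<j j≤b = subst (λ z → nth0 D z ≡ M ∸ (b ∸ j)) (sym (∸-suc e j j<e))
        (nth0-next D (e ∸ suc j) v w D-strict previous w∈D w<v (λ u _ u<v → ≤-pred (subst (u <_) v≡1+w u<v)))
      where
      j<b : j < b
      j<b = m∸n≢0⇒n<m (λ b∸j≡0 → 0≢1+n (trans (sym b∸j≡0) b∸j≡k+1))
      j<e : j < e
      j<e = <-≤-trans j<b b≤e
      v : ℕ
      v = M ∸ (b ∸ suc j)
      w : ℕ
      w = M ∸ (b ∸ j)
      previous : nth0 D (e ∸ suc j) ≡ v
      previous = rank-below k (suc j) (suc-injective (trans (sym (∸-suc b j j<b)) b∸j≡k+1)) (<-trans lo<j (n<1+n j)) j<b
      b∸j-1<M : b ∸ suc j < M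
      b∸j-1<M = <-≤-trans (<-≤-trans (∸-monoʳ-< (<-trans lo<j (n<1+n j)) j<b) (m≤n+m (b ∸ lo) (σ b)))
                          (room-below-M b lo<b ≤-refl)
      v≡1+w : v ≡ suc w
      v≡1+w = trans (∸-suc M (b ∸ suc j) b∸j-1<M) (cong (λ z → suc (M ∸ z)) (sym (∸-suc b j j<b)))
      w<v : w < v
      w<v = subst (w <_) (sym v≡1+w) ≤-refl
      w∈D : w ∈ D
      w∈D with occurs-by-e w (≤-trans (m+n≤o⇒m≤o∸n (σ b) (room-below-M b lo<b ≤-refl)) (∸-monoʳ-≤ M (∸-monoʳ-≤ b (<⇒≤ lo<j))))
                             (m∸n≤m M (b ∸ j))
      ... | c , 1≤c , c≤e , σc≡w = subst (_∈ D) σc≡w (∈values↓⁺ σ e c 1≤c c≤e)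

  ΨR-in-carrel : ∀ j → lo < j → j ≤ e → ΨR n R π j ≡ nth0 D (e ∸ j)
  ΨR-in-carrel j lo<j j≤e = begin
    rank (cEnd n R j ∸ j + 1) (map π (range (cEnd n R j)))  ≡⟨ cong (λ z → rank (z ∸ j + 1) (map π (range z))) (end≡ j lo<j j≤e) ⟩
    rank (e ∸ j + 1) (map π (range e))                      ≡⟨ cong (λ l → nth0 (reverse l) (e ∸ j + 1 ∸ 1)) (sort-resp-↭ (prefix-↭ n R σ π proj e e≤n (inj₂ e∈R))) ⟩
    nth0 D (e ∸ j + 1 ∸ 1)                                  ≡⟨ cong (nth0 D) (m+n∸n≡m (e ∸ j) 1) ⟩
    nth0 D (e ∸ j)                                          ∎
    where open ≡-Reasoning

  ΨR-at-lo : lo ∈ R → ΨR n R π lo ≡ M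
  ΨR-at-lo lo∈ = begin
    rank (cEnd n R lo ∸ lo + 1) (map π (range (cEnd n R lo))) ≡⟨ cong (λ z → rank (z ∸ lo + 1) (map π (range z))) (cEnd-self n R lo lo≤n (inj₂ lo∈)) ⟩
    rank (lo ∸ lo + 1) (map π (range lo))                     ≡⟨ cong (λ l → nth0 (reverse l) (lo ∸ lo + 1 ∸ 1)) (sort-resp-↭ (prefix-↭ n R σ π proj lo lo≤n (inj₂ (inj₂ lo∈)))) ⟩
    nth0 (values↓ σ lo) (lo ∸ lo + 1 ∸ 1)                     ≡⟨ cong (nth0 (values↓ σ lo)) (trans (m+n∸n≡m (lo ∸ lo) 1) (n∸n≡0 lo)) ⟩
    nth0 (values↓ σ lo) 0                                     ≡⟨ values↓-head n σ perm lo lo≤n ⟩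
    M                                                         ∎
    where
    open ≡-Reasoning
    lo≤n : lo ≤ n
    lo≤n = <⇒≤ (<-≤-trans lo<e e≤n)

  ΨR-above : ∀ j → lo < j → j ≤ e → b ≤ j → ΨR n R π j ≡ Ψ σ j
  ΨR-above j lo<j j≤e b≤j = trans (ΨR-in-carrel j lo<j j≤e) (rank-above (e ∸ j) j refl b≤j lo<j j≤e)

  ΨR-below : ∀ j → lo < j → j ≤ b → ΨR n R π j ≡ M ∸ (b ∸ j)
  ΨR-below j lo<j j≤b = trans (ΨR-in-carrel j lo<j (≤-trans j≤b b≤e))
    (RanksBelowThreshold.rank-below (<-≤-trans lo<j j≤b) (b ∸ j) j refl lo<j j≤b)

  core-agrees : ∀ i → lo < i → i ≤ e → coreValue (Ψ σ) lo e i ≡ ΨR n R π i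
  core-agrees i lo<i i≤e with b ≤? i
  ... | yes b≤i = trans (CoreOfShape.core-above (Ψ σ) lo b e Ψ-shape i lo<i i≤e b≤i) (sym (ΨR-above i lo<i i≤e b≤i))
  ... | no b≰i = begin
    coreValue (Ψ σ) lo e i  ≡⟨ CoreOfShape.core-below (Ψ σ) lo b e Ψ-shape i lo<i i≤e i≤b ⟩
    Ψ σ b ∸ (b ∸ i)         ≡⟨ cong (_∸ (b ∸ i)) (Ψ-flat b lo≤b ≤-refl) ⟩
    M ∸ (b ∸ i)             ≡⟨ sym (ΨR-below i lo<i i≤b) ⟩
    ΨR n R π i              ∎
    where
    open ≡-Reasoning
    i≤b : i ≤ b
    i≤b = <⇒≤ (≰⇒> b≰i)

  -- Ψ_R(π) has no drop onto b from (lo, b], so its critical indices stay at or above b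
  ΨR-flat : ∀ y → lo < y → y ≤ b → ΨR n R π b ≤ ΨR n R π y + (b ∸ y)
  ΨR-flat y lo<y y≤b = subst₂ (λ u v → u ≤ v + (b ∸ y))
    (sym (trans (ΨR-above b (<-≤-trans lo<y y≤b) b≤e ≤-refl) (Ψ-flat b lo≤b ≤-refl))) (sym (ΨR-below y lo<y y≤b))
    (subst (M ≤_) (+-comm (b ∸ y) (M ∸ (b ∸ y))) (m≤n+m∸n M (b ∸ y)))

  b≤first-critical : b ≤ foldr _⊓_ e (critChain (ΨR n R π) lo e e)
  b≤first-critical = foldr-⊓-lower b e _ b≤e (chain-above (ΨR n R π) lo b e e ΨR-flat b≤e)

  raised-agrees : ∀ i → lo < i → i ≤ e → raisedValue R (ΨR n R π) lo e i ≡ Ψ σ i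
  raised-agrees i lo<i i≤e with b ≤? i
  ... | yes b≤i = if-cases (elemᵇ lo R ∧ _) raised (ΨR-above i lo<i i≤e b≤i)
    where
    raised : elemᵇ lo R ∧ _ ≡ true → ΨR n R π lo ⊔ ΨR n R π i ≡ Ψ σ i
    raised holds = trans (cong₂ _⊔_ (ΨR-at-lo (elemᵇ⁻ lo R (proj₁ (∧-true _ _ holds)))) (ΨR-above i lo<i i≤e b≤i))
                         (m≤n⇒m⊔n≡n (Ψ-mono σ lo i (<⇒≤ lo<i)))
  ... | no b≰i = trans (if-true (elemᵇ lo R ∧ _) holds) (begin
    ΨR n R π lo ⊔ ΨR n R π i  ≡⟨ cong₂ _⊔_ (ΨR-at-lo lo∈R′) (ΨR-below i lo<i (<⇒≤ i<b)) ⟩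
    M ⊔ (M ∸ (b ∸ i))         ≡⟨ m≥n⇒m⊔n≡m (m∸n≤m M (b ∸ i)) ⟩
    M                         ≡⟨ sym (Ψ-flat i (<⇒≤ lo<i) (<⇒≤ i<b)) ⟩
    Ψ σ i                     ∎)
    where
    open ≡-Reasoning
    i<b : i < b
    i<b = ≰⇒> b≰i
    -- lo is a genuine carrel end, since 1 ≤ lo when the threshold is above lo
    lo∈R′ : lo ∈ R
    lo∈R′ with lo∈R
    ... | inj₂ lo∈ = lo∈
    ... | inj₁ lo≡0 = ⊥-elim (<⇒≱ (BelowThreshold.1≤lo (<-trans lo<i i<b)) (≤-reflexive lo≡0))
    holds : elemᵇ lo R ∧ (lo <ᵇ i) ∧ (i <ᵇ foldr _⊓_ e (critChain (ΨR n R π) lo e e)) ≡ true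
    holds rewrite elemᵇ⁺ lo R lo∈R′ | T-to-≡ (<⇒<ᵇ lo<i) | T-to-≡ (<⇒<ᵇ (<-≤-trans i<b b≤first-critical)) = refl

elemᵇ-false : ∀ x xs → x ∉ xs → elemᵇ x xs ≡ false
elemᵇ-false x xs x∉ with elemᵇ x xs in found
... | true  = ⊥-elim (x∉ (elemᵇ⁻ x xs found))
... | false = refl

maxNotIn-char : ∀ m S v → v ≤ m → 1 ≤ v → v ∉ S → (∀ u → v < u → u ≤ m → u ∈ S) → maxNotIn m S ≡ v
maxNotIn-char zero S v v≤0 1≤v _ _ = ⊥-elim (<⇒≱ 1≤v v≤0)
maxNotIn-char (suc m) S v v≤m+1 1≤v v∉ taken with m≤n⇒m<n∨m≡n v≤m+1
... | inj₂ refl rewrite elemᵇ-false (suc m) S v∉ = refl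
... | inj₁ v<m+1 rewrite elemᵇ⁺ (suc m) S (taken (suc m) v<m+1 ≤-refl) =
  maxNotIn-char m S v (≤-pred v<m+1) 1≤v v∉ (λ u v<u u≤m → taken u v<u (m≤n⇒m≤1+n u≤m))

Π-step : ∀ n σ → IsPerm n σ → Avoids312 n σ → ∀ k → suc k ≤ n
  → maxNotIn (Ψ σ (suc k)) (map σ (range k)) ≡ σ (suc k)
Π-step n σ perm avoids k k<n = maxNotIn-char (Ψ σ (suc k)) used (σ (suc k))
  (Ψ-upper σ (suc k) (suc k) (s≤s z≤n) ≤-refl) (proj₁ (perm-range perm k+1∈[n])) new taken
  where
  used : List ℕ
  used = map σ (range k)
  k+1∈[n] : InRange n (suc k)
  k+1∈[n] = s≤s z≤n , k<n
  within : ∀ {c} → 1 ≤ c → c ≤ k → InRange n c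
  within 1≤c c≤k = 1≤c , ≤-trans c≤k (≤-trans (n≤1+n k) k<n)
  new : σ (suc k) ∉ used
  new σk+1∈ with ∈-map⁻ σ σk+1∈
  ... | c , c∈ , σk+1≡σc with ∈range⁻ k c∈
  ... | 1≤c , c≤k = <⇒≢ (s≤s c≤k) (sym (perm-inj perm k+1∈[n] (within 1≤c c≤k) σk+1≡σc))
  -- a value u in (σ_{k+1}, Ψ(σ)_{k+1}] placed after k+1 would complete a 312 pattern
  taken : ∀ u → σ (suc k) < u → u ≤ Ψ σ (suc k) → u ∈ used
  taken u σk+1<u u≤Ψ with Ψ-attained σ (suc k) (s≤s z≤n)
  ... | a , 1≤a , a≤k+1 , Ψ≡σa
    with perm-surjective n σ perm u (≤-trans (s≤s z≤n) σk+1<u ,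
                                      ≤-trans u≤Ψ (subst (_≤ n) (sym Ψ≡σa) (proj₂ (perm-range perm (1≤a , ≤-trans a≤k+1 k<n)))))
  ...   | c , (1≤c , c≤n) , σc≡u with c ≤? k
  ...     | yes c≤k = subst (_∈ used) σc≡u (∈-map⁺ σ (∈range⁺ k 1≤c c≤k))
  ...     | no c≰k with m≤n⇒m<n∨m≡n (≰⇒> c≰k)
  ...       | inj₂ refl = ⊥-elim (<-irrefl σc≡u σk+1<u)
  ...       | inj₁ k+1<c = ⊥-elim (avoids (a , suc k , c , 1≤a , a<k+1 , k+1<c , c≤n , subst (σ (suc k) <_) (sym σc≡u) σk+1<u , σc<σa))
    where
    a<k+1 : a < suc k
    a<k+1 = ≤∧≢⇒< a≤k+1 (λ { refl → <⇒≱ σk+1<u (subst (u ≤_) Ψ≡σa u≤Ψ) })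
    σc<σa : σ c < σ a
    σc<σa = ≤∧≢⇒< (subst₂ _≤_ (sym σc≡u) Ψ≡σa u≤Ψ)
      (λ σc≡σa → <⇒≢ (<-trans a<k+1 k+1<c) (perm-inj perm (1≤a , ≤-trans a≤k+1 k<n) (1≤c , c≤n) (sym σc≡σa)))

ΠList-Ψ : ∀ n σ → IsPerm n σ → Avoids312 n σ → ∀ k → k ≤ n → ΠList (Ψ σ) k ≡ map σ (range k)
ΠList-Ψ n σ perm avoids zero _ = refl
ΠList-Ψ n σ perm avoids (suc k) k<n = begin
  ΠList (Ψ σ) k ∷ʳ maxNotIn (Ψ σ (suc k)) (ΠList (Ψ σ) k) ≡⟨ cong (λ L → L ∷ʳ maxNotIn (Ψ σ (suc k)) L) earlier ⟩
  map σ (range k) ∷ʳ maxNotIn (Ψ σ (suc k)) (map σ (range k)) ≡⟨ cong (map σ (range k) ∷ʳ_) (Π-step n σ perm avoids k k<n) ⟩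
  map σ (range k) ∷ʳ σ (suc k)                             ≡⟨ sym (map-++ σ (range k) [ suc k ]) ⟩
  map σ (range k ∷ʳ suc k)                                 ≡⟨ cong (map σ) (sym (range-suc k)) ⟩
  map σ (range (suc k))                                    ∎
  where
  open ≡-Reasoning
  earlier : ΠList (Ψ σ) k ≡ map σ (range k)
  earlier = ΠList-Ψ n σ perm avoids k (≤-trans (n≤1+n k) k<n)

Π-Ψ : ∀ n σ → IsPerm n σ → Avoids312 n σ → ∀ i → InRange n i → Π (Ψ σ) i ≡ σ i
Π-Ψ n σ perm avoids (suc k) (_ , k<n) =
  trans (cong (maxNotIn (Ψ σ (suc k))) (ΠList-Ψ n σ perm avoids k (≤-trans (n≤1+n k) k<n))) (Π-step n σ perm avoids k k<n)

ΠList-cong : ∀ φ φ′ k → (∀ j → 1 ≤ j → j ≤ k → φ j ≡ φ′ j) → ΠList φ k ≡ ΠList φ′ k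
ΠList-cong φ φ′ zero _ = refl
ΠList-cong φ φ′ (suc k) φ≡ = cong₂ (λ L m → L ∷ʳ maxNotIn m L)
  (ΠList-cong φ φ′ k (λ j 1≤j j≤k → φ≡ j 1≤j (m≤n⇒m≤1+n j≤k))) (φ≡ (suc k) (s≤s z≤n) ≤-refl)

Π-cong : ∀ φ φ′ k → (∀ j → 1 ≤ j → j ≤ k → φ j ≡ φ′ j) → Π φ k ≡ Π φ′ k
Π-cong φ φ′ zero _ = refl
Π-cong φ φ′ (suc k) φ≡ = cong₂ maxNotIn (φ≡ (suc k) (s≤s z≤n) ≤-refl)
  (ΠList-cong φ φ′ k (λ j 1≤j j≤k → φ≡ j 1≤j (m≤n⇒m≤1+n j≤k)))

module _ (n : ℕ) (R : List ℕ) (π σ : ℕ → ℕ) (perm : IsPerm n σ) (avoids : Avoids312 n σ)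
  (proj : ∀ i → InRange n i → projR n R σ i ≡ π i) (minimal : MinimalLift n R π σ) where

  private
    module OnCarrelOf (i : ℕ) (ri : InRange n i) =
      MinimalOnCarrel n R π σ perm avoids proj minimal (cStart R i) (cEnd n R i) (carrelOf n R i ri)

  core-at : ∀ i → InRange n i → ΔR n R (Ψ σ) i ≡ ΨR n R π i
  core-at i ri@(1≤i , i≤n) = OnCarrelOf.core-agrees i ri i (maxBelow-< i R 1≤i) (minAtLeast-≥ i R n i≤n)

  raise-at : ∀ i → InRange n i → ΦR n R (ΨR n R π) i ≡ Ψ σ i
  raise-at i ri@(1≤i , i≤n) = OnCarrelOf.raised-agrees i ri i (maxBelow-< i R 1≤i) (minAtLeast-≥ i R n i≤n)

proposition7p2 : (n : ℕ) → 1 ≤ n → (R : List ℕ) → ValidR n R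
    → (π : ℕ → ℕ) → InSnR n R π → R312Avoiding n R π
    → (σ : ℕ → ℕ) → IsPerm n σ → Avoids312 n σ
    → (∀ i → InRange n i → projR n R σ i ≡ π i)
    → (∀ τ → IsPerm n τ → Avoids312 n τ → (∀ i → InRange n i → projR n R τ i ≡ π i)
         → inversions n σ ≤ inversions n τ)
    → (∀ i → InRange n i → ΔR n R (Ψ σ) i ≡ ΨR n R π i)
      × (∀ i → InRange n i → σ i ≡ Π (ΦR n R (ΨR n R π)) i)
proposition7p2 n _ R _ π _ _ σ perm avoids proj minimal =
  core-at n R π σ perm avoids proj minimal , reconstruction
  where
  reconstruction : ∀ i → InRange n i → σ i ≡ Π (ΦR n R (ΨR n R π)) i
  reconstruction i ri@(_ , i≤n) = sym (begin
    Π (ΦR n R (ΨR n R π)) i  ≡⟨ Π-cong _ _ i (λ j 1≤j j≤i → raise-at n R π σ perm avoids proj minimal j (1≤j , ≤-trans j≤i i≤n)) ⟩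
    Π (Ψ σ) i                ≡⟨ Π-Ψ n σ perm avoids i ri ⟩
    σ i                      ∎)
    where open ≡-Reasoning
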